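{- Let $l\ge1$, $m\ge2$, $n\ge1$, let $C$ be a generalized Dellac configuration of size $n$ with type $(l,m)$, let $\pi=\phi(C)$ and let $L$ be the length of $\pi$ (so $L=l(2(m-1)n+2)$ if $mn$ is even and $L=2l(m-1)n$ if $mn$ is odd). Let $\pi^{o}$ (resp. $\pi^{e}$) be the subsequence of $\pi$ formed by the entries $\pi(pl+q)$, $1\le q\le l$, with $p$ even (resp. $p$ odd), $0\le p\le L/l-1$, taken in their order in $\pi$. Then $$\frac{L^2}{4}-\sum_{\substack{0\le p\le L/l-1\\ p\ \mathrm{odd}}}\ \sum_{q=1}^{l}\pi(pl+q)-\mathrm{inv}(\pi^{o})-\mathrm{inv}(\pi^{e})=\binom{L/2}{2}-\mathrm{inv}(C).$$
   Context: A generalized Dellac configuration of size $n$ with type $(l,m)$ is a set of $lmn$ boxes ("dots") in a grid of width $ln$ (columns from left to right) and height $mn$ (rows $1,\dots,mn$ from bottom to top), such that each row contains exactly $l$ dots, each column contains exactly $m$ dots, and a dot in row $i$, column $j$ satisfies $\lceil j/l\rceil\le i\le\lceil j/l\rceil+(m-1)n$. $\mathrm{inv}(C)$ is the number of pairs of dots one of which lies strictly above and strictly to the left of the other. For a word $w$, $\mathrm{inv}(w)$ is the number of pairs $i<j$ with $w_i>w_j$. Labels: if $mn$ is even, every dot in row $i$ ($1\le i\le mn/2$) gets label $2i+n(m-2)+2$ and every dot in row $mn/2+i$ ($1\le i\le mn/2$) gets label $2i-1$. If $mn$ is odd, every dot in row $i$ ($1\le i\le (mn-1)/2$) gets label $2i+n(m-2)+1$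 and every dot in row $(mn-1)/2+i$ ($1\le i\le (mn+1)/2$) gets label $2i-1$. $\mathrm{word}(C)$ is obtained by reading the labels column by column from left to right, each column from bottom to top. Writing $a^l$ for $l$ copies of $a$: for $mn$ even, $w_1=2^l4^l\cdots(n(m-2)+2)^l$ and $w_2=(mn+1)^l(mn+3)^l\cdots(2n(m-1)+1)^l$; for $mn$ odd, $w_1=2^l4^l\cdots((m-2)n+1)^l$ and $w_2=(mn+2)^l(mn+4)^l\cdots(2(m-1)n-1)^l$. Put $\phi_1(C)=w_1\,\mathrm{word}(C)\,w_2$ (concatenation); each value $k$ in $\{1,\dots,L/l\}$ occurs exactly $l$ times in it. $\phi(C)=\beta$ is the permutation of $\{1,\dots,L\}$ defined by: if value $k$ occurs in $\phi_1(C)$ at positions $i_1<\dots<i_l$, then $\beta_{l(k-1)+p}=i_p$ for $1\le p\le l$. -}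

module Defs where

open import Data.Nat using (ℕ; zero; suc; _+_; _*_; _∸_; _≤_; _<ᵇ_; _≡ᵇ_; NonZero)
open import Data.Nat.DivMod using (_/_; _%_)
open import Data.Bool using (Bool; true; false; _∧_; if_then_else_)
open import Data.Fin using (Fin; toℕ)
open import Data.List using (List; []; _∷_; _++_; map; concatMap; replicate; upTo; allFin; length)
open import Data.Nat.ListAction using (sum)
open import Data.Product using (_×_)
open import Relation.Binary.PropositionalEquality using (_≡_)

countᵇ : {A : Set} → (A → Bool) → List A → ℕ
countᵇ p []       = 0
countᵇ p (x ∷ xs) = (if p x then 1 else 0) + countᵇ p xs

⌈_/_⌉ : ℕ → (b : ℕ) → .{{NonZero b}} → ℕ
⌈ a / b ⌉ = (a + b ∸ 1) / b

-- A dot configuration in the (l n) × (m n) grid: dots r c = true iff there is a dot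
-- in row (toℕ r + 1) (rows 1..mn from bottom to top) and column (toℕ c + 1)
-- (columns 1..ln from left to right).
Config : (l m n : ℕ) → Set
Config l m n = Fin (m * n) → Fin (l * n) → Bool

record IsGenDellac (l m n : ℕ) .{{_ : NonZero l}} (C : Config l m n) : Set where
  field
    rowCount : ∀ r → countᵇ (λ c → C r c) (allFin (l * n)) ≡ l
    colCount : ∀ c → countᵇ (λ r → C r c) (allFin (m * n)) ≡ m
    bounds   : ∀ r c → C r c ≡ true →
               (⌈ toℕ c + 1 / l ⌉ ≤ toℕ r + 1) ×
               (toℕ r + 1 ≤ ⌈ toℕ c + 1 / l ⌉ + (m ∸ 1) * n)

invC : {l m n : ℕ} → Config l m n → ℕ
invC {l} {m} {n} C =
  sum (map (λ r₁ → sum (map (λ c₁ → sum (map (λ r₂ → countᵇ (λ c₂ →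
        C r₁ c₁ ∧ C r₂ c₂ ∧ (toℕ r₂ <ᵇ toℕ r₁) ∧ (toℕ c₁ <ᵇ toℕ c₂))
      (allFin (l * n))) (allFin (m * n)))) (allFin (l * n)))) (allFin (m * n)))

invW : List ℕ → ℕ
invW []       = 0
invW (x ∷ xs) = countᵇ (λ y → y <ᵇ x) xs + invW xs

even? : ℕ → Bool
even? k = k % 2 ≡ᵇ 0

-- Label of a dot in row i (1-based).
label : (m n i : ℕ) → ℕ
label m n i with even? (m * n)
... | true  = if i <ᵇ (m * n) / 2 + 1 then 2 * i + n * (m ∸ 2) + 2
                                      else 2 * (i ∸ (m * n) / 2) ∸ 1
... | false = if i <ᵇ (m * n ∸ 1) / 2 + 1 then 2 * i + n * (m ∸ 2) + 1
                                          else 2 * (i ∸ (m * n ∸ 1) / 2) ∸ 1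

word : {l m n : ℕ} → Config l m n → List ℕ
word {l} {m} {n} C =
  concatMap (λ c → concatMap (λ r → if C r c then label m n (toℕ r + 1) ∷ [] else [])
                             (allFin (m * n)))
            (allFin (l * n))

-- a, a+2, a+4, ..., up to b (empty if a > b).
stepRange : ℕ → ℕ → List ℕ
stepRange a b = map (λ k → a + 2 * k) (upTo ((b + 2 ∸ a) / 2))

rep : ℕ → List ℕ → List ℕ
rep l = concatMap (replicate l)

w₁ : (l m n : ℕ) → List ℕ
w₁ l m n with even? (m * n)
... | true  = rep l (stepRange 2 (n * (m ∸ 2) + 2))
... | false = rep l (stepRange 2 ((m ∸ 2) * n + 1))

w₂ : (l m n : ℕ) → List ℕ
w₂ l m n with even? (m * n)
... | true  = rep l (stepRange (m * n + 1) (2 * n * (m ∸ 1) + 1))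
... | false = rep l (stepRange (m * n + 2) (2 * (m ∸ 1) * n ∸ 1))

φ₁ : (l m n : ℕ) → Config l m n → List ℕ
φ₁ l m n C = w₁ l m n ++ word {l} {m} {n} C ++ w₂ l m n

positionsFrom : ℕ → ℕ → List ℕ → List ℕ
positionsFrom s k []       = []
positionsFrom s k (x ∷ xs) = if x ≡ᵇ k then s ∷ positionsFrom (suc s) k xs
                                        else positionsFrom (suc s) k xs

-- φ(C) = β, as the list β₁ β₂ ... β_L: the block for value k (k = 1..L/l) lists
-- the positions i₁ < ... < i_l of k in φ₁(C).
φ : (l m n : ℕ) .{{_ : NonZero l}} → Config l m n → List ℕ
φ l m n C = concatMap (λ k → positionsFrom 1 (suc k) w) (upTo (length w / l))
  where w = φ₁ l m n C

-- 1-based lookup π(i) (0 outside the range).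
at : List ℕ → ℕ → ℕ
at []       i             = 0
at (x ∷ xs) zero          = 0
at (x ∷ xs) (suc zero)    = x
at (x ∷ xs) (suc (suc i)) = at xs (suc i)

blockSub : (l : ℕ) .{{_ : NonZero l}} → Bool → List ℕ → List ℕ
blockSub l par π =
  concatMap (λ p → if even? p ≡ᵇᵇ par then map (λ q → at π (p * l + suc q)) (upTo l) else [])
            (upTo (length π / l))
  where
  _≡ᵇᵇ_ : Bool → Bool → Bool
  true  ≡ᵇᵇ b = b
  false ≡ᵇᵇ true  = false
  false ≡ᵇᵇ false = true

πo : (l : ℕ) .{{_ : NonZero l}} → List ℕ → List ℕ
πo l = blockSub l true

πe : (l : ℕ) .{{_ : NonZero l}} → List ℕ → List ℕ
πe l = blockSub l false

oddBlockSum : (l : ℕ) .{{_ : NonZero l}} → List ℕ → ℕ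
oddBlockSum l π =
  sum (map (λ p → if even? p then 0 else sum (map (λ q → at π (p * l + suc q)) (upTo l)))
           (upTo (length π / l)))

-- φ(C) is the inverse of the word φ₁(C): its p-th block of l entries lists the positions of the
-- letter p + 1, increasingly.  Hence the odd-numbered blocks (those of the even letters) sum to
-- E + (E choose 2) + #{odd letter before even letter}, where E = L/2 is the number of even
-- letters, while inv(πᵒ) and inv(πᵉ) count the inversions of φ₁(C) among its odd, resp. even,
-- letters.  So the left-hand side is (L/2 choose 2) minus the number of inversions of φ₁(C) for
-- the order ⊏ listing the even letters before the odd ones.  Replacing every letter by its rank
-- for ⊏, w₁ becomes a sorted word below everything else, w₂ a sorted word above everything else,
-- and word(C) the row indices of the dots read column by column, shifted by a constant.  The
-- inversions left are those of this column reading, i.e. the pairs of dots counted by inv(C).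
module Submission where

open import Defs
open import Function using (_∘_; id)
open import Data.Nat
open import Data.Nat.Properties
open import Data.Nat.DivMod using (m*n/n≡m; m*n%n≡0; [m+kn]%n≡m%n)
open import Data.Nat.Combinatorics using (_C_; nC1≡n; nCk+nC[k+1]≡[n+1]C[k+1])
open import Data.Nat.ListAction using (sum)
open import Data.Nat.ListAction.Properties using (sum-++)
open import Data.Nat.Tactic.RingSolver using (solve-∀)
open import Algebra.Properties.CommutativeSemigroup +-commutativeSemigroup using (interchange; x∙yz≈y∙xz)
open import Data.Bool using (Bool; true; false; not; _∧_; _∨_; if_then_else_)
open import Data.Bool.Properties using (∧-zeroʳ; ∧-identityʳ)
open import Data.List using (List; []; _∷_; _++_; map; concat; concatMap; replicate; upTo; applyUpTo; length; tabulate; allFin)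
open import Data.Fin using (Fin; toℕ)
open import Data.Fin.Properties using (toℕ<n)
open import Data.List.Properties using (length-++; map-upTo; map-applyUpTo; map-cong; map-++; concat-++; ++-assoc; concatMap-cong; map-concatMap; map-tabulate; map-cong-local; map-∘; map-replicate)
open import Data.List.Relation.Unary.All using (All; []; _∷_)
import Data.List.Relation.Unary.All as All
open import Data.List.Relation.Unary.All.Properties using (++⁺; ++⁻ˡ; ++⁻ʳ; replicate⁺; concat⁺; map⁺; applyUpTo⁺₁)
open import Data.Unit using (⊤)
open import Data.Integer using (_-_)
import Data.Integer as ℤ
import Data.Integer.Properties as ℤ
import Data.Integer.Tactic.RingSolver as ℤ-Solver
open import Data.List.Relation.Unary.AllPairs using (AllPairs; []; _∷_)
import Data.List.Relation.Unary.AllPairs as AllPairs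
open import Data.List.Relation.Unary.AllPairs.Properties using (tabulate⁺-<) renaming (applyUpTo⁺₁ to allPairs-applyUpTo⁺₁)
open import Data.Product using (_×_; _,_; proj₁; proj₂; ∃-syntax)
open import Data.Sum using (_⊎_; inj₁; inj₂)
open import Relation.Nullary using (yes; no; contradiction)
open import Relation.Binary.PropositionalEquality
open ≡-Reasoning

-- Counting

ind : Bool → ℕ
ind b = if b then 1 else 0

ind-∧ : ∀ a b → ind (a ∧ b) ≡ ind a * ind b
ind-∧ true  b = sym (+-identityʳ (ind b))
ind-∧ false b = refl

<ᵇ-true : ∀ {m n} → m < n → (m <ᵇ n) ≡ true
<ᵇ-true {zero} {suc n} _ = refl
<ᵇ-true {suc m} {suc n} (s<s m<n) = <ᵇ-true m<n

<ᵇ-false : ∀ {m n} → n ≤ m → (m <ᵇ n) ≡ false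
<ᵇ-false {m} {zero} _ = refl
<ᵇ-false {suc m} {suc n} (s≤s n≤m) = <ᵇ-false n≤m

<ᵇ-cong : ∀ {m n m′ n′} → (m < n → m′ < n′) → (m′ < n′ → m < n) → (m <ᵇ n) ≡ (m′ <ᵇ n′)
<ᵇ-cong {m} {n} {m′} {n′} to from with m <? n | m′ <? n′
... | yes lt | yes lt′ = trans (<ᵇ-true lt) (sym (<ᵇ-true lt′))
... | no ¬lt | no ¬lt′ = trans (<ᵇ-false (≮⇒≥ ¬lt)) (sym (<ᵇ-false (≮⇒≥ ¬lt′)))
... | yes lt | no ¬lt′ = contradiction (to lt) ¬lt′
... | no ¬lt | yes lt′ = contradiction (from lt′) ¬lt

≡ᵇ-refl : ∀ n → (n ≡ᵇ n) ≡ true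
≡ᵇ-refl zero    = refl
≡ᵇ-refl (suc n) = ≡ᵇ-refl n

≡ᵇ-false : ∀ {m n} → m ≢ n → (m ≡ᵇ n) ≡ false
≡ᵇ-false {zero}  {zero}  m≢n = contradiction refl m≢n
≡ᵇ-false {zero}  {suc n} m≢n = refl
≡ᵇ-false {suc m} {zero}  m≢n = refl
≡ᵇ-false {suc m} {suc n} m≢n = ≡ᵇ-false (m≢n ∘ cong suc)

≡ᵇ-cong : ∀ {m n m′ n′} → (m ≡ n → m′ ≡ n′) → (m′ ≡ n′ → m ≡ n) → (m ≡ᵇ n) ≡ (m′ ≡ᵇ n′)
≡ᵇ-cong {m} {n} {m′} {n′} to from with m ≟ n | m′ ≟ n′
... | yes refl | yes refl = trans (≡ᵇ-refl m) (sym (≡ᵇ-refl m′))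
... | no m≢n   | no m′≢n′ = trans (≡ᵇ-false m≢n) (sym (≡ᵇ-false m′≢n′))
... | yes m≡n  | no m′≢n′ = contradiction (to m≡n) m′≢n′
... | no m≢n   | yes m′≡n′ = contradiction (from m′≡n′) m≢n

module _ {A : Set} where

  countᵇ-++ : ∀ (p : A → Bool) xs ys → countᵇ p (xs ++ ys) ≡ countᵇ p xs + countᵇ p ys
  countᵇ-++ p []       ys = refl
  countᵇ-++ p (x ∷ xs) ys = trans (cong (ind (p x) +_) (countᵇ-++ p xs ys)) (sym (+-assoc (ind (p x)) _ _))

  countᵇ-concat : ∀ (p : A → Bool) xss → countᵇ p (concat xss) ≡ sum (map (countᵇ p) xss)
  countᵇ-concat p []         = refl
  countᵇ-concat p (xs ∷ xss) = trans (countᵇ-++ p xs (concat xss)) (cong (countᵇ p xs +_) (countᵇ-concat p xss))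

  countᵇ-cong : ∀ {p q : A → Bool} {xs} → All (λ x → p x ≡ q x) xs → countᵇ p xs ≡ countᵇ q xs
  countᵇ-cong []             = refl
  countᵇ-cong (px≡qx ∷ rest) = cong₂ (λ b n → ind b + n) px≡qx (countᵇ-cong rest)

  countᵇ-false : ∀ (xs : List A) → countᵇ (λ _ → false) xs ≡ 0
  countᵇ-false []       = refl
  countᵇ-false (x ∷ xs) = countᵇ-false xs

  countᵇ-none : ∀ {p : A → Bool} {xs} → All (λ x → p x ≡ false) xs → countᵇ p xs ≡ 0
  countᵇ-none {xs = xs} px≡false = trans (countᵇ-cong px≡false) (countᵇ-false xs)

  countᵇ-∧ˡ : ∀ b (p : A → Bool) xs → countᵇ (λ x → b ∧ p x) xs ≡ (if b then countᵇ p xs else 0)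
  countᵇ-∧ˡ true  p xs = refl
  countᵇ-∧ˡ false p xs = countᵇ-false xs

  countᵇ-map : ∀ {B : Set} (p : B → Bool) (f : A → B) xs → countᵇ p (map f xs) ≡ countᵇ (p ∘ f) xs
  countᵇ-map p f []       = refl
  countᵇ-map p f (x ∷ xs) = cong (ind (p (f x)) +_) (countᵇ-map p f xs)

  countᵇ-+ : ∀ {p q r : A → Bool} → (∀ x → ind (p x) + ind (q x) ≡ ind (r x)) →
             ∀ xs → countᵇ p xs + countᵇ q xs ≡ countᵇ r xs
  countᵇ-+ p+q≡r []       = refl
  countᵇ-+ {p} {q} p+q≡r (x ∷ xs) =
    trans (interchange (ind (p x)) (countᵇ p xs) (ind (q x)) (countᵇ q xs)) (cong₂ _+_ (p+q≡r x) (countᵇ-+ p+q≡r xs))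

  countᵇ-replicate : ∀ (p : A → Bool) l x → countᵇ p (replicate l x) ≡ l * ind (p x)
  countᵇ-replicate p zero    x = refl
  countᵇ-replicate p (suc l) x = cong (ind (p x) +_) (countᵇ-replicate p l x)

countᵇ-all : ∀ {A : Set} {p : A → Bool} {xs} → All (λ x → p x ≡ true) xs → countᵇ p xs ≡ length xs
countᵇ-all []             = refl
countᵇ-all (px≡true ∷ ps) rewrite px≡true = cong suc (countᵇ-all ps)

countᵇ-applyUpTo : ∀ (p : ℕ → Bool) f n → countᵇ p (applyUpTo f n) ≡ countᵇ (p ∘ f) (upTo n)
countᵇ-applyUpTo p f n = trans (cong (countᵇ p) (sym (map-upTo f n))) (countᵇ-map p f (upTo n))

countᵇ-middle : ∀ {A : Set} (p : A → Bool) xs y zs → countᵇ p (xs ++ y ∷ zs) ≡ ind (p y) + countᵇ p (xs ++ zs)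
countᵇ-middle p []       y zs = refl
countᵇ-middle p (x ∷ xs) y zs = trans (cong (ind (p x) +_) (countᵇ-middle p xs y zs)) (x∙yz≈y∙xz (ind (p x)) (ind (p y)) _)

countᵇ-rep : ∀ (p : ℕ → Bool) l xs → countᵇ p (rep l xs) ≡ l * countᵇ p xs
countᵇ-rep p l []       = sym (*-zeroʳ l)
countᵇ-rep p l (x ∷ xs) = begin
  countᵇ p (replicate l x ++ rep l xs)          ≡⟨ countᵇ-++ p (replicate l x) (rep l xs) ⟩
  countᵇ p (replicate l x) + countᵇ p (rep l xs) ≡⟨ cong₂ _+_ (countᵇ-replicate p l x) (countᵇ-rep p l xs) ⟩
  l * ind (p x) + l * countᵇ p xs               ≡⟨ *-distribˡ-+ l (ind (p x)) (countᵇ p xs) ⟨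
  l * countᵇ p (x ∷ xs)                          ∎

countᵇ-≡ᵇ-upTo : ∀ {k N} → k < N → countᵇ (_≡ᵇ k) (upTo N) ≡ 1
countᵇ-≡ᵇ-upTo {zero}  {suc N} _ = cong suc (trans (countᵇ-applyUpTo (_≡ᵇ 0) suc N) (countᵇ-false (upTo N)))
countᵇ-≡ᵇ-upTo {suc k} {suc N} (s<s k<N) = trans (countᵇ-applyUpTo (_≡ᵇ suc k) suc N) (countᵇ-≡ᵇ-upTo k<N)

countᵇ-odd-upTo : ∀ H → countᵇ (not ∘ even?) (upTo (H * 2)) ≡ H
countᵇ-odd-upTo zero    = refl
countᵇ-odd-upTo (suc H) = cong suc (trans (countᵇ-applyUpTo (not ∘ even?) (suc ∘ suc) (H * 2)) (countᵇ-odd-upTo H))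

Replicates : ℕ → List ℕ → List ℕ → Set
Replicates l xs ys = ∀ (q : ℕ → Bool) → countᵇ q xs ≡ l * countᵇ q ys

rep-replicates : ∀ l ys → Replicates l (rep l ys) ys
rep-replicates l ys q = countᵇ-rep q l ys

++-replicates : ∀ {l xs ys xs′ ys′} → Replicates l xs ys → Replicates l xs′ ys′ →
                Replicates l (xs ++ xs′) (ys ++ ys′)
++-replicates {l} {xs} {ys} {xs′} {ys′} r r′ q = begin
  countᵇ q (xs ++ xs′)                 ≡⟨ countᵇ-++ q xs xs′ ⟩
  countᵇ q xs + countᵇ q xs′           ≡⟨ cong₂ _+_ (r q) (r′ q) ⟩
  l * countᵇ q ys + l * countᵇ q ys′   ≡⟨ *-distribˡ-+ l (countᵇ q ys) (countᵇ q ys′) ⟨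
  l * (countᵇ q ys + countᵇ q ys′)     ≡⟨ cong (l *_) (countᵇ-++ q ys ys′) ⟨
  l * countᵇ q (ys ++ ys′)             ∎

map-replicates : ∀ {l xs ys} (f : ℕ → ℕ) → Replicates l xs ys → Replicates l (map f xs) (map f ys)
map-replicates {l} {xs} {ys} f r q = begin
  countᵇ q (map f xs)      ≡⟨ countᵇ-map q f xs ⟩
  countᵇ (q ∘ f) xs        ≡⟨ r (q ∘ f) ⟩
  l * countᵇ (q ∘ f) ys    ≡⟨ cong (l *_) (countᵇ-map q f ys) ⟨
  l * countᵇ q (map f ys)  ∎

-- Finite sums

∑ : ∀ {A : Set} → List A → (A → ℕ) → ℕ
∑ xs f = sum (map f xs)

syntax ∑ xs (λ x → e) = ∑[ x ∈ xs ] e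

∑-cong : ∀ {A : Set} (xs : List A) {f g : A → ℕ} → (∀ x → f x ≡ g x) → ∑ xs f ≡ ∑ xs g
∑-cong xs f≗g = cong sum (map-cong f≗g xs)

∑-zero : ∀ {A : Set} (xs : List A) → ∑[ x ∈ xs ] 0 ≡ 0
∑-zero []       = refl
∑-zero (x ∷ xs) = ∑-zero xs

∑-+ : ∀ {A : Set} (xs : List A) (f g : A → ℕ) → ∑[ x ∈ xs ] (f x + g x) ≡ ∑ xs f + ∑ xs g
∑-+ []       f g = refl
∑-+ (x ∷ xs) f g = trans (cong (f x + g x +_) (∑-+ xs f g)) (interchange (f x) (g x) (∑ xs f) (∑ xs g))

∑-*ˡ : ∀ {A : Set} (xs : List A) k (f : A → ℕ) → ∑[ x ∈ xs ] (k * f x) ≡ k * ∑ xs f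
∑-*ˡ []       k f = sym (*-zeroʳ k)
∑-*ˡ (x ∷ xs) k f = trans (cong (k * f x +_) (∑-*ˡ xs k f)) (sym (*-distribˡ-+ k (f x) (∑ xs f)))

∑-swap : ∀ {A B : Set} (xs : List A) (ys : List B) (f : A → B → ℕ) →
         ∑[ x ∈ xs ] ∑[ y ∈ ys ] f x y ≡ ∑[ y ∈ ys ] ∑[ x ∈ xs ] f x y
∑-swap []       ys f = sym (∑-zero ys)
∑-swap (x ∷ xs) ys f = trans (cong (∑ ys (f x) +_) (∑-swap xs ys f)) (sym (∑-+ ys (f x) (λ y → ∑[ x′ ∈ xs ] f x′ y)))

countᵇ≡∑ : ∀ {A : Set} (p : A → Bool) xs → countᵇ p xs ≡ ∑[ x ∈ xs ] ind (p x)
countᵇ≡∑ p []       = refl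
countᵇ≡∑ p (x ∷ xs) = cong (ind (p x) +_) (countᵇ≡∑ p xs)

∑-cong-All : ∀ {A : Set} {f g : A → ℕ} {xs} → All (λ x → f x ≡ g x) xs → ∑ xs f ≡ ∑ xs g
∑-cong-All []          = refl
∑-cong-All (eq ∷ eqs) = cong₂ _+_ eq (∑-cong-All eqs)

∑-map : ∀ {A B : Set} (g : A → B) (f : B → ℕ) xs → ∑ (map g xs) f ≡ ∑[ x ∈ xs ] f (g x)
∑-map g f []       = refl
∑-map g f (x ∷ xs) = cong (f (g x) +_) (∑-map g f xs)

pairSum : ∀ {A : Set} → (A → A → ℕ) → List A → ℕ
pairSum Y []       = 0
pairSum Y (x ∷ xs) = ∑ xs (Y x) + pairSum Y xs

pairSum-map : ∀ {A B : Set} (Y : B → B → ℕ) (g : A → B) xs → pairSum Y (map g xs) ≡ pairSum (λ a b → Y (g a) (g b)) xs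
pairSum-map Y g []       = refl
pairSum-map Y g (x ∷ xs) = cong₂ _+_ (∑-map g (Y (g x)) xs) (pairSum-map Y g xs)

pairSum-sorted : ∀ {A : Set} (_≺_ : A → A → Bool) (Y : A → A → ℕ) {xs} → (∀ x → (x ≺ x) ≡ false) →
                 AllPairs (λ x y → (x ≺ y) ≡ true × (y ≺ x) ≡ false) xs →
                 pairSum Y xs ≡ ∑[ x ∈ xs ] ∑[ y ∈ xs ] (ind (x ≺ y) * Y x y)
pairSum-sorted _≺_ Y {[]}     irrefl []              = refl
pairSum-sorted _≺_ Y {x ∷ xs} irrefl (x≺xs ∷ sorted) = begin
  ∑ xs (Y x) + pairSum Y xs
    ≡⟨ cong₂ _+_ (∑-cong-All (All.map later x≺xs)) (pairSum-sorted _≺_ Y irrefl sorted) ⟩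
  ∑[ y ∈ xs ] (ind (x ≺ y) * Y x y) + ∑[ x′ ∈ xs ] ∑[ y ∈ xs ] (ind (x′ ≺ y) * Y x′ y)
    ≡⟨ cong₂ _+_ (cong (λ b → ind b * Y x x + ∑[ y ∈ xs ] (ind (x ≺ y) * Y x y)) (sym (irrefl x))) (∑-cong-All (All.map earlier x≺xs)) ⟩
  (ind (x ≺ x) * Y x x + ∑[ y ∈ xs ] (ind (x ≺ y) * Y x y))
    + ∑[ x′ ∈ xs ] (ind (x′ ≺ x) * Y x′ x + ∑[ y ∈ xs ] (ind (x′ ≺ y) * Y x′ y)) ∎
  where
  later : ∀ {y} → (x ≺ y) ≡ true × (y ≺ x) ≡ false → Y x y ≡ ind (x ≺ y) * Y x y
  later (x≺y , _) rewrite x≺y = sym (+-identityʳ _)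
  earlier : ∀ {x′} → (x ≺ x′) ≡ true × (x′ ≺ x) ≡ false →
            ∑[ y ∈ xs ] (ind (x′ ≺ y) * Y x′ y) ≡ ind (x′ ≺ x) * Y x′ x + ∑[ y ∈ xs ] (ind (x′ ≺ y) * Y x′ y)
  earlier (_ , x′⊀x) rewrite x′⊀x = refl

applyUpTo-cong : ∀ {A : Set} {f g : ℕ → A} n → (∀ {i} → i < n → f i ≡ g i) → applyUpTo f n ≡ applyUpTo g n
applyUpTo-cong zero    f≡g = refl
applyUpTo-cong (suc n) f≡g = cong₂ _∷_ (f≡g z<s) (applyUpTo-cong n (f≡g ∘ s<s))

applyUpTo-split : ∀ {A : Set} (f : ℕ → A) p r →
                  applyUpTo f (suc p + r) ≡ applyUpTo f p ++ f p ∷ applyUpTo (λ i → f (suc p + i)) r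
applyUpTo-split f zero    r = refl
applyUpTo-split f (suc p) r = cong (f 0 ∷_) (applyUpTo-split (f ∘ suc) p r)

applyUpTo-++ : ∀ {A : Set} (f : ℕ → A) a b → applyUpTo f (a + b) ≡ applyUpTo f a ++ applyUpTo (λ i → f (a + i)) b
applyUpTo-++ f zero    b = refl
applyUpTo-++ f (suc a) b = cong (f 0 ∷_) (applyUpTo-++ (f ∘ suc) a b)

tabulate-toℕ : ∀ {A : Set} (f : ℕ → A) N → tabulate {n = N} (f ∘ toℕ) ≡ applyUpTo f N
tabulate-toℕ f zero    = refl
tabulate-toℕ f (suc N) = cong (f 0 ∷_) (tabulate-toℕ (f ∘ suc) N)

countᵇ-allFin : ∀ (q : ℕ → Bool) N → countᵇ (q ∘ toℕ) (allFin N) ≡ countᵇ q (upTo N)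
countᵇ-allFin q N = begin
  countᵇ (q ∘ toℕ) (allFin N)         ≡⟨ countᵇ-map q toℕ (allFin N) ⟨
  countᵇ q (map toℕ (allFin N))       ≡⟨ cong (countᵇ q) (map-tabulate {n = N} id toℕ) ⟩
  countᵇ q (tabulate {n = N} toℕ)     ≡⟨ cong (countᵇ q) (tabulate-toℕ id N) ⟩
  countᵇ q (upTo N)                   ∎

allFin-sorted : ∀ N → AllPairs (λ i j → toℕ i < toℕ j) (allFin N)
allFin-sorted N = tabulate⁺-< id

map-rep : ∀ (f : ℕ → ℕ) l xs → map f (rep l xs) ≡ rep l (map f xs)
map-rep f l []       = refl
map-rep f l (x ∷ xs) = trans (map-++ f (replicate l x) (rep l xs)) (cong₂ _++_ (map-replicate f l x) (map-rep f l xs))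

rep-All : ∀ {P : ℕ → Set} l {xs} → All P xs → All P (rep l xs)
rep-All l Pxs = concat⁺ (map⁺ (All.map (replicate⁺ l) Pxs))

sum-concat : ∀ xss → sum (concat xss) ≡ sum (map sum xss)
sum-concat []         = refl
sum-concat (xs ∷ xss) = trans (sum-++ xs (concat xss)) (cong (sum xs +_) (sum-concat xss))

length-middle : ∀ {A : Set} (xs ys zs : List A) → length (xs ++ ys ++ zs) ≡ length ys + length (xs ++ zs)
length-middle xs ys zs = begin
  length (xs ++ ys ++ zs)                ≡⟨ length-++ xs ⟩
  length xs + length (ys ++ zs)          ≡⟨ cong (length xs +_) (length-++ ys) ⟩
  length xs + (length ys + length zs)    ≡⟨ x∙yz≈y∙xz (length xs) (length ys) (length zs) ⟩
  length ys + (length xs + length zs)    ≡⟨ cong (length ys +_) (length-++ xs) ⟨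
  length ys + length (xs ++ zs)          ∎

sum-middle : ∀ xs ys zs → sum (xs ++ ys ++ zs) ≡ sum ys + sum (xs ++ zs)
sum-middle xs ys zs = begin
  sum (xs ++ ys ++ zs)            ≡⟨ sum-++ xs (ys ++ zs) ⟩
  sum xs + sum (ys ++ zs)         ≡⟨ cong (sum xs +_) (sum-++ ys zs) ⟩
  sum xs + (sum ys + sum zs)      ≡⟨ x∙yz≈y∙xz (sum xs) (sum ys) (sum zs) ⟩
  sum ys + (sum xs + sum zs)      ≡⟨ cong (sum ys +_) (sum-++ xs zs) ⟨
  sum ys + sum (xs ++ zs)         ∎

two-step-induction : ∀ {P : ℕ → Set} → P 0 → P 1 → (∀ p → P p → P (suc (suc p))) → ∀ p → P p
two-step-induction P0 P1 step zero          = P0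
two-step-induction P0 P1 step (suc zero)    = P1
two-step-induction P0 P1 step (suc (suc p)) = step p (two-step-induction P0 P1 step p)

select-cong : ∀ {f g : ℕ → Bool} (X : ℕ → List ℕ) → (∀ p → f p ≡ g p) → ∀ ps →
              concatMap (λ p → if f p then X p else []) ps ≡ concatMap (λ p → if g p then X p else []) ps
select-cong X f≗g = concatMap-cong (λ p → cong (λ b → if b then X p else []) (f≗g p))

at-++ˡ : ∀ xs ys {i} → i < length xs → at (xs ++ ys) (suc i) ≡ at xs (suc i)
at-++ˡ (x ∷ xs) ys {zero}  _          = refl
at-++ˡ (x ∷ xs) ys {suc i} (s<s i<n) = at-++ˡ xs ys i<n

at-++ʳ : ∀ xs ys i → at (xs ++ ys) (length xs + suc i) ≡ at ys (suc i)
at-++ʳ []       ys i = refl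
at-++ʳ (x ∷ xs) ys i = begin
  at (x ∷ xs ++ ys) (suc (length xs + suc i))  ≡⟨ cong (λ k → at (x ∷ xs ++ ys) (suc k)) (+-suc (length xs) i) ⟩
  at (xs ++ ys) (suc (length xs + i))          ≡⟨ cong (at (xs ++ ys)) (+-suc (length xs) i) ⟨
  at (xs ++ ys) (length xs + suc i)            ≡⟨ at-++ʳ xs ys i ⟩
  at ys (suc i)                                ∎

map-at-upTo : ∀ xs → map (λ q → at xs (suc q)) (upTo (length xs)) ≡ xs
map-at-upTo []       = refl
map-at-upTo (x ∷ xs) = cong (x ∷_) (trans (map-applyUpTo suc _ (length xs)) (trans (sym (map-upTo _ (length xs))) (map-at-upTo xs)))

suc-C-2 : ∀ n → suc n C 2 ≡ n + n C 2
suc-C-2 n = trans (sym (nCk+nC[k+1]≡[n+1]C[k+1] n 1)) (cong (_+ n C 2) (nC1≡n n))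

square-C-2 : ∀ n → n * n ≡ n + n C 2 + n C 2
square-C-2 zero    = refl
square-C-2 (suc n) = begin
  suc n * suc n                              ≡⟨ expand n ⟩
  suc n + n + n * n                          ≡⟨ cong (λ k → suc n + n + k) (square-C-2 n) ⟩
  suc n + n + (n + n C 2 + n C 2)            ≡⟨ regroup n (n C 2) ⟩
  suc n + (n + n C 2) + (n + n C 2)          ≡⟨ cong (λ k → suc n + k + k) (suc-C-2 n) ⟨
  suc n + suc n C 2 + suc n C 2              ∎
  where
  expand : ∀ n → suc n * suc n ≡ suc n + n + n * n
  expand = solve-∀
  regroup : ∀ n c → suc n + n + (n + c + c) ≡ suc n + (n + c) + (n + c)
  regroup = solve-∀

ℤ-cancel : ∀ e c o i j → ℤ.+ (e + c + c) - ℤ.+ (1 * e + c + o) - ℤ.+ i - ℤ.+ j ≡ ℤ.+ c - ℤ.+ (o + i + j)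
ℤ-cancel e c o i j
  rewrite *-identityˡ e | ℤ.pos-+ (e + c) c | ℤ.pos-+ e c | ℤ.pos-+ (e + c) o | ℤ.pos-+ (o + i) j | ℤ.pos-+ o i
  = cancel (ℤ.+ e) (ℤ.+ c) (ℤ.+ o) (ℤ.+ i) (ℤ.+ j)
  where
  cancel : ∀ e c o i j → e ℤ.+ c ℤ.+ c - (e ℤ.+ c ℤ.+ o) - i - j ≡ c - (o ℤ.+ i ℤ.+ j)
  cancel = ℤ-Solver.solve-∀

*2≡+ : ∀ n → n * 2 ≡ n + n
*2≡+ n = trans (*-comm n 2) (cong (n +_) (+-identityʳ n))

suc-*2 : ∀ n → suc n * 2 ≡ 2 + 2 * n
suc-*2 n = cong (2 +_) (*-comm n 2)

data ParityView : ℕ → Set where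
  even : ∀ i → ParityView (i * 2)
  odd  : ∀ i → ParityView (1 + i * 2)

parityView : ∀ n → ParityView n
parityView zero    = even 0
parityView (suc n) with parityView n
... | even i = odd i
... | odd  i = even (suc i)

parity-split : ∀ k → (∃[ j ] k ≡ j * 2) ⊎ (∃[ j ] k ≡ 1 + j * 2)
parity-split k with parityView k
... | even j = inj₁ (j , refl)
... | odd  j = inj₂ (j , refl)

-- Inversions

invBy : ∀ {A : Set} → (A → A → Bool) → List A → ℕ
invBy R []       = 0
invBy R (x ∷ xs) = countᵇ (R x) xs + invBy R xs

module _ {A : Set} where

  invBy-map : ∀ {B : Set} (R : B → B → Bool) (f : A → B) w → invBy R (map f w) ≡ invBy (λ x y → R (f x) (f y)) w
  invBy-map R f []       = refl
  invBy-map R f (x ∷ xs) = cong₂ _+_ (countᵇ-map (R (f x)) f xs) (invBy-map R f xs)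

  invBy-cong : ∀ {P : A → Set} {R S : A → A → Bool} → (∀ {x y} → P x → P y → R x y ≡ S x y) →
               ∀ {w} → All P w → invBy R w ≡ invBy S w
  invBy-cong R≡S []         = refl
  invBy-cong R≡S (px ∷ pxs) = cong₂ _+_ (countᵇ-cong (All.map (R≡S px) pxs)) (invBy-cong R≡S pxs)

  invBy-none : ∀ {R : A → A → Bool} {w} → AllPairs (λ x y → R x y ≡ false) w → invBy R w ≡ 0
  invBy-none []                = refl
  invBy-none (Rxy≡false ∷ rest) = cong₂ _+_ (countᵇ-none Rxy≡false) (invBy-none rest)

  invBy-+ : ∀ {R S T : A → A → Bool} → (∀ x y → ind (R x y) + ind (S x y) ≡ ind (T x y)) →
            ∀ w → invBy R w + invBy S w ≡ invBy T w
  invBy-+ {R} {S} {T} R+S≡T []       = refl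
  invBy-+ {R} {S} {T} R+S≡T (x ∷ xs) = begin
    countᵇ (R x) xs + invBy R xs + (countᵇ (S x) xs + invBy S xs)
      ≡⟨ interchange (countᵇ (R x) xs) (invBy R xs) (countᵇ (S x) xs) (invBy S xs) ⟩
    countᵇ (R x) xs + countᵇ (S x) xs + (invBy R xs + invBy S xs)
      ≡⟨ cong₂ _+_ (countᵇ-+ (R+S≡T x) xs) (invBy-+ R+S≡T xs) ⟩
    countᵇ (T x) xs + invBy T xs ∎

invW≡invBy : ∀ w → invW w ≡ invBy (λ x y → y <ᵇ x) w
invW≡invBy []       = refl
invW≡invBy (x ∷ xs) = cong (countᵇ (_<ᵇ x) xs +_) (invW≡invBy xs)

cross : List ℕ → List ℕ → ℕ
cross xs ys = ∑[ x ∈ xs ] countᵇ (_<ᵇ x) ys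

invW-++ : ∀ xs ys → invW (xs ++ ys) ≡ invW xs + invW ys + cross xs ys
invW-++ []       ys = sym (+-identityʳ (invW ys))
invW-++ (x ∷ xs) ys = begin
  countᵇ (_<ᵇ x) (xs ++ ys) + invW (xs ++ ys)
    ≡⟨ cong₂ _+_ (countᵇ-++ (_<ᵇ x) xs ys) (invW-++ xs ys) ⟩
  countᵇ (_<ᵇ x) xs + countᵇ (_<ᵇ x) ys + (invW xs + invW ys + cross xs ys)
    ≡⟨ shuffle (countᵇ (_<ᵇ x) xs) (countᵇ (_<ᵇ x) ys) (invW xs) (invW ys) (cross xs ys) ⟩
  countᵇ (_<ᵇ x) xs + invW xs + invW ys + (countᵇ (_<ᵇ x) ys + cross xs ys) ∎
  where
  shuffle : ∀ a b c d e → a + b + (c + d + e) ≡ a + c + d + (b + e)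
  shuffle = solve-∀

cross-≤ : ∀ {a xs ys} → All (_≤ a) xs → All (a ≤_) ys → cross xs ys ≡ 0
cross-≤ []            ys≥a = refl
cross-≤ (x≤a ∷ xs≤a) ys≥a =
  cong₂ _+_ (countᵇ-none (All.map (λ a≤y → <ᵇ-false (≤-trans x≤a a≤y)) ys≥a)) (cross-≤ xs≤a ys≥a)

invW-map-+ : ∀ a xs → invW (map (a +_) xs) ≡ invW xs
invW-map-+ a xs = begin
  invW (map (a +_) xs)                           ≡⟨ invW≡invBy (map (a +_) xs) ⟩
  invBy (λ x y → y <ᵇ x) (map (a +_) xs)         ≡⟨ invBy-map (λ x y → y <ᵇ x) (a +_) xs ⟩
  invBy (λ x y → a + y <ᵇ a + x) xs              ≡⟨ invBy-cong {P = λ _ → ⊤} (λ _ _ → shift) (All.universal _ xs) ⟩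
  invBy (λ x y → y <ᵇ x) xs                      ≡⟨ invW≡invBy xs ⟨
  invW xs                                        ∎
  where
  shift : ∀ {x y} → (a + y <ᵇ a + x) ≡ (y <ᵇ x)
  shift = <ᵇ-cong (+-cancelˡ-< a _ _) (+-monoʳ-< a)

invW-replicate : ∀ l x → invW (replicate l x) ≡ 0
invW-replicate zero    x = refl
invW-replicate (suc l) x = cong₂ _+_ (countᵇ-none (replicate⁺ l (<ᵇ-false {x} ≤-refl))) (invW-replicate l x)

invW-rep-sorted : ∀ l {xs} → AllPairs _≤_ xs → invW (rep l xs) ≡ 0
invW-rep-sorted l {[]}     []               = refl
invW-rep-sorted l {x ∷ xs} (x≤xs ∷ sorted) = begin
  invW (replicate l x ++ rep l xs)
    ≡⟨ invW-++ (replicate l x) (rep l xs) ⟩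
  invW (replicate l x) + invW (rep l xs) + cross (replicate l x) (rep l xs)
    ≡⟨ cong₂ (λ a b → a + b + cross (replicate l x) (rep l xs)) (invW-replicate l x) (invW-rep-sorted l sorted) ⟩
  cross (replicate l x) (rep l xs)
    ≡⟨ cross-≤ (replicate⁺ l ≤-refl) (rep-All l x≤xs) ⟩
  0 ∎

invW-sandwich : ∀ {a b xs ys zs} → a ≤ b → All (_≤ a) xs → All (λ y → a ≤ y × y ≤ b) ys → All (b ≤_) zs →
                invW xs ≡ 0 → invW zs ≡ 0 → invW (xs ++ ys ++ zs) ≡ invW ys
invW-sandwich {a} {b} {xs} {ys} {zs} a≤b xs≤a ys∈[a,b] zs≥b xs-sorted zs-sorted = begin
  invW (xs ++ ys ++ zs)
    ≡⟨ invW-++ xs (ys ++ zs) ⟩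
  invW xs + invW (ys ++ zs) + cross xs (ys ++ zs)
    ≡⟨ cong₂ (λ i c → i + invW (ys ++ zs) + c) xs-sorted (cross-≤ xs≤a (++⁺ (All.map proj₁ ys∈[a,b]) (All.map (≤-trans a≤b) zs≥b))) ⟩
  invW (ys ++ zs) + 0
    ≡⟨ +-identityʳ _ ⟩
  invW (ys ++ zs)
    ≡⟨ invW-++ ys zs ⟩
  invW ys + invW zs + cross ys zs
    ≡⟨ cong₂ (λ i c → invW ys + i + c) zs-sorted (cross-≤ (All.map proj₂ ys∈[a,b]) zs≥b) ⟩
  invW ys + 0 + 0
    ≡⟨ trans (+-identityʳ _) (+-identityʳ _) ⟩
  invW ys ∎

cross-concat : ∀ xs yss → cross xs (concat yss) ≡ ∑[ ys ∈ yss ] cross xs ys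
cross-concat xs yss = begin
  ∑[ x ∈ xs ] countᵇ (_<ᵇ x) (concat yss)          ≡⟨ ∑-cong xs (λ x → countᵇ-concat (_<ᵇ x) yss) ⟩
  ∑[ x ∈ xs ] ∑[ ys ∈ yss ] countᵇ (_<ᵇ x) ys      ≡⟨ ∑-swap xs yss (λ x ys → countᵇ (_<ᵇ x) ys) ⟩
  ∑[ ys ∈ yss ] cross xs ys                        ∎

invW-concat : ∀ xss → invW (concat xss) ≡ ∑ xss invW + pairSum cross xss
invW-concat []         = refl
invW-concat (xs ∷ xss) = begin
  invW (xs ++ concat xss)
    ≡⟨ invW-++ xs (concat xss) ⟩
  invW xs + invW (concat xss) + cross xs (concat xss)
    ≡⟨ cong₂ (λ i c → invW xs + i + c) (invW-concat xss) (cross-concat xs xss) ⟩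
  invW xs + (∑ xss invW + pairSum cross xss) + ∑ xss (cross xs)
    ≡⟨ regroup (invW xs) (∑ xss invW) (pairSum cross xss) (∑ xss (cross xs)) ⟩
  invW xs + ∑ xss invW + (∑ xss (cross xs) + pairSum cross xss) ∎
  where
  regroup : ∀ a b c d → a + (b + c) + d ≡ a + b + (d + c)
  regroup = solve-∀

invW-insert-min : ∀ s xs zs → All (s <_) xs → All (s <_) zs → invW (xs ++ s ∷ zs) ≡ length xs + invW (xs ++ zs)
invW-insert-min s []       zs []          zs>s = cong (_+ invW zs) (countᵇ-none (All.map (λ s<z → <ᵇ-false (<⇒≤ s<z)) zs>s))
invW-insert-min s (x ∷ xs) zs (s<x ∷ xs>s) zs>s = begin
  countᵇ (_<ᵇ x) (xs ++ s ∷ zs) + invW (xs ++ s ∷ zs)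
    ≡⟨ cong₂ _+_ (countᵇ-middle (_<ᵇ x) xs s zs) (invW-insert-min s xs zs xs>s zs>s) ⟩
  ind (s <ᵇ x) + countᵇ (_<ᵇ x) (xs ++ zs) + (length xs + invW (xs ++ zs))
    ≡⟨ cong (λ b → ind b + countᵇ (_<ᵇ x) (xs ++ zs) + (length xs + invW (xs ++ zs))) (<ᵇ-true s<x) ⟩
  suc (countᵇ (_<ᵇ x) (xs ++ zs) + (length xs + invW (xs ++ zs)))
    ≡⟨ cong suc (x∙yz≈y∙xz (countᵇ (_<ᵇ x) (xs ++ zs)) (length xs) (invW (xs ++ zs))) ⟩
  suc (length xs + (countᵇ (_<ᵇ x) (xs ++ zs) + invW (xs ++ zs))) ∎

selectMap : ∀ {A : Set} → (A → Bool) → (A → ℕ) → List A → List ℕ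
selectMap p f = concatMap (λ x → if p x then f x ∷ [] else [])

module _ {A : Set} (p : A → Bool) (f : A → ℕ) where

  countᵇ-selectMap : ∀ (q : ℕ → Bool) xs → countᵇ q (selectMap p f xs) ≡ countᵇ (λ x → p x ∧ q (f x)) xs
  countᵇ-selectMap q []       = refl
  countᵇ-selectMap q (x ∷ xs) with p x
  ... | true  = cong (ind (q (f x)) +_) (countᵇ-selectMap q xs)
  ... | false = countᵇ-selectMap q xs

  invW-selectMap : ∀ xs → invW (selectMap p f xs) ≡ invBy (λ x y → p x ∧ (p y ∧ (f y <ᵇ f x))) xs
  invW-selectMap []       = refl
  invW-selectMap (x ∷ xs) with p x
  ... | true  = cong₂ _+_ (countᵇ-selectMap (_<ᵇ f x) xs) (invW-selectMap xs)
  ... | false = trans (invW-selectMap xs) (sym (cong (_+ invBy _ xs) (countᵇ-false xs)))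

  ∑-selectMap : ∀ (g : ℕ → ℕ) xs → ∑ (selectMap p f xs) g ≡ ∑[ x ∈ xs ] (if p x then g (f x) else 0)
  ∑-selectMap g []       = refl
  ∑-selectMap g (x ∷ xs) with p x
  ... | true  = cong (g (f x) +_) (∑-selectMap g xs)
  ... | false = ∑-selectMap g xs

  map-selectMap : ∀ (h : ℕ → ℕ) xs → map h (selectMap p f xs) ≡ selectMap p (h ∘ f) xs
  map-selectMap h []       = refl
  map-selectMap h (x ∷ xs) with p x
  ... | true  = cong (h (f x) ∷_) (map-selectMap h xs)
  ... | false = map-selectMap h xs

-- The blocks of the inverse of a word

InRange : ℕ → ℕ → Set
InRange V x = 1 ≤ x × x ≤ V

marker : Bool → ℕ → List ℕ
marker b s = if b then s ∷ [] else []

invW-insert-marker : ∀ b s xs zs → All (s <_) xs → All (s <_) zs →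
                     invW (xs ++ marker b s ++ zs) ≡ (if b then length xs else 0) + invW (xs ++ zs)
invW-insert-marker true  s xs zs xs>s zs>s = invW-insert-min s xs zs xs>s zs>s
invW-insert-marker false s xs zs xs>s zs>s = refl

positionsFrom-≥ : ∀ s k w → All (s ≤_) (positionsFrom s k w)
positionsFrom-≥ s k []       = []
positionsFrom-≥ s k (x ∷ xs) with x ≡ᵇ k
... | true  = ≤-refl ∷ All.map <⇒≤ (positionsFrom-≥ (suc s) k xs)
... | false = All.map <⇒≤ (positionsFrom-≥ (suc s) k xs)

length-positionsFrom : ∀ s k w → length (positionsFrom s k w) ≡ countᵇ (_≡ᵇ k) w
length-positionsFrom s k []       = refl
length-positionsFrom s k (x ∷ xs) with x ≡ᵇ k
... | true  = cong suc (length-positionsFrom (suc s) k xs)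
... | false = length-positionsFrom (suc s) k xs

selectedBlock : (ℕ → Bool) → ℕ → List ℕ → ℕ → List ℕ
selectedBlock c s w p = if c (suc p) then positionsFrom s (suc p) w else []

selectBlocks : (ℕ → Bool) → ℕ → List ℕ → ℕ → List ℕ
selectBlocks c s w V = concat (applyUpTo (selectedBlock c s w) V)

selectedBlock-miss : ∀ c s {x} xs p → x ≢ suc p → selectedBlock c s (x ∷ xs) p ≡ selectedBlock c (suc s) xs p
selectedBlock-miss c s {x} xs p x≢ with c (suc p)
... | false = refl
... | true  rewrite ≡ᵇ-false x≢ = refl

selectedBlock-hit : ∀ c s xs p → selectedBlock c s (suc p ∷ xs) p ≡ marker (c (suc p)) s ++ selectedBlock c (suc s) xs p
selectedBlock-hit c s xs p with c (suc p)
... | false = refl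
... | true  rewrite ≡ᵇ-refl p = refl

selectBlocks-skip : ∀ c s {V} p xs → V ≤ p → selectBlocks c s (suc p ∷ xs) V ≡ selectBlocks c (suc s) xs V
selectBlocks-skip c s {V} p xs V≤p =
  cong concat (applyUpTo-cong V (λ i<V → selectedBlock-miss c s xs _ (λ eq → <⇒≢ (<-≤-trans i<V V≤p) (suc-injective (sym eq)))))

selectBlocks-∷ : ∀ c s {V} p xs → p < V →
  ∃[ R ] selectBlocks c s (suc p ∷ xs) V ≡ selectBlocks c (suc s) xs p ++ marker (c (suc p)) s ++ R
       × selectBlocks c (suc s) xs V ≡ selectBlocks c (suc s) xs p ++ R
selectBlocks-∷ c s p xs p<V with r , refl ← m≤n⇒∃[o]m+o≡n p<V = R , with-marker , without-marker
  where
  B B′ : ℕ → List ℕ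
  B  = selectedBlock c s (suc p ∷ xs)
  B′ = selectedBlock c (suc s) xs
  R : List ℕ
  R = B′ p ++ concat (applyUpTo (λ i → B′ (suc p + i)) r)
  with-marker : concat (applyUpTo B (suc p + r)) ≡ concat (applyUpTo B′ p) ++ marker (c (suc p)) s ++ R
  with-marker = begin
    concat (applyUpTo B (suc p + r))
      ≡⟨ cong concat (applyUpTo-split B p r) ⟩
    concat (applyUpTo B p ++ B p ∷ applyUpTo (λ i → B (suc p + i)) r)
      ≡⟨ concat-++ (applyUpTo B p) _ ⟨
    concat (applyUpTo B p) ++ B p ++ concat (applyUpTo (λ i → B (suc p + i)) r)
      ≡⟨ cong₂ (λ X Y → concat X ++ Y)
           (applyUpTo-cong p (λ i<p → selectedBlock-miss c s xs _ (λ eq → <⇒≢ i<p (suc-injective (sym eq)))))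
           (cong₂ (λ Y Z → Y ++ concat Z)
             (selectedBlock-hit c s xs p)
             (applyUpTo-cong r (λ {i} _ → selectedBlock-miss c s xs _ (λ eq → <⇒≢ (s≤s (m≤m+n p i)) (suc-injective eq))))) ⟩
    concat (applyUpTo B′ p) ++ (marker (c (suc p)) s ++ B′ p) ++ concat (applyUpTo (λ i → B′ (suc p + i)) r)
      ≡⟨ cong (concat (applyUpTo B′ p) ++_) (++-assoc (marker (c (suc p)) s) (B′ p) _) ⟩
    concat (applyUpTo B′ p) ++ marker (c (suc p)) s ++ R ∎
  without-marker : concat (applyUpTo B′ (suc p + r)) ≡ concat (applyUpTo B′ p) ++ R
  without-marker = trans (cong concat (applyUpTo-split B′ p r)) (sym (concat-++ (applyUpTo B′ p) _))

selectBlocks-≥ : ∀ c s w V → All (s ≤_) (selectBlocks c s w V)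
selectBlocks-≥ c s w V = concat⁺ (applyUpTo⁺₁ (selectedBlock c s w) V (λ {p} _ → block-≥ p))
  where
  block-≥ : ∀ p → All (s ≤_) (selectedBlock c s w p)
  block-≥ p with c (suc p)
  ... | true  = positionsFrom-≥ s (suc p) w
  ... | false = []

selectBlocks-[] : ∀ c s V → selectBlocks c s [] V ≡ []
selectBlocks-[] c s zero    = refl
selectBlocks-[] c s (suc V) = cong₂ _++_ (if-same (c 1)) (selectBlocks-[] (c ∘ suc) s V)
  where
  if-same : ∀ b → (if b then [] else []) ≡ []
  if-same true  = refl
  if-same false = refl

length-marker : ∀ b s → length (marker b s) ≡ ind b
length-marker true  s = refl
length-marker false s = refl

length-selectBlocks : ∀ c s V w → All (1 ≤_) w →
                      length (selectBlocks c s w V) ≡ countᵇ (λ y → c y ∧ (y <ᵇ suc V)) w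
length-selectBlocks c s V []       []               = cong length (selectBlocks-[] c s V)
length-selectBlocks c s V (suc p ∷ xs) (s≤s z≤n ∷ xs≥1) with p <? V
... | yes p<V with R , with-marker , without-marker ← selectBlocks-∷ c s p xs p<V = begin
  length (selectBlocks c s (suc p ∷ xs) V)
    ≡⟨ cong length with-marker ⟩
  length (A ++ marker (c (suc p)) s ++ R)
    ≡⟨ length-middle A (marker (c (suc p)) s) R ⟩
  length (marker (c (suc p)) s) + length (A ++ R)
    ≡⟨ cong₂ _+_ (trans (length-marker (c (suc p)) s) (cong ind (sym (∧-true (c (suc p))))))
                 (trans (cong length (sym without-marker)) (length-selectBlocks c (suc s) V xs xs≥1)) ⟩
  ind (c (suc p) ∧ (p <ᵇ V)) + countᵇ (λ y → c y ∧ (y <ᵇ suc V)) xs ∎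
  where
  A : List ℕ
  A = selectBlocks c (suc s) xs p
  ∧-true : ∀ b → b ∧ (p <ᵇ V) ≡ b
  ∧-true b = trans (cong (b ∧_) (<ᵇ-true p<V)) (∧-identityʳ b)
... | no p≮V = begin
  length (selectBlocks c s (suc p ∷ xs) V)
    ≡⟨ cong length (selectBlocks-skip c s p xs (≮⇒≥ p≮V)) ⟩
  length (selectBlocks c (suc s) xs V)
    ≡⟨ length-selectBlocks c (suc s) V xs xs≥1 ⟩
  countᵇ (λ y → c y ∧ (y <ᵇ suc V)) xs
    ≡⟨ cong (λ b → ind b + countᵇ (λ y → c y ∧ (y <ᵇ suc V)) xs)
            (sym (trans (cong (c (suc p) ∧_) (<ᵇ-false (≮⇒≥ p≮V))) (∧-zeroʳ (c (suc p))))) ⟩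
  ind (c (suc p) ∧ (p <ᵇ V)) + countᵇ (λ y → c y ∧ (y <ᵇ suc V)) xs ∎

sum-marker : ∀ b s → sum (marker b s) ≡ (if b then s else 0)
sum-marker true  s = +-identityʳ s
sum-marker false s = refl

-- the position of a selected letter is s plus the number of letters before it
sum-selectBlocks : ∀ c s V w → All (InRange V) w →
  sum (selectBlocks c s w V) ≡ s * countᵇ c w + countᵇ c w C 2 + invBy (λ x y → not (c x) ∧ c y) w
sum-selectBlocks c s V []       []  rewrite selectBlocks-[] c s V | *-zeroʳ s = refl
sum-selectBlocks c s V (suc p ∷ xs) ((s≤s z≤n , p<V) ∷ xs∈V)
  with R , with-marker , without-marker ← selectBlocks-∷ c s p xs p<V = begin
  sum (selectBlocks c s (suc p ∷ xs) V)
    ≡⟨ cong sum with-marker ⟩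
  sum (A ++ marker (c (suc p)) s ++ R)
    ≡⟨ sum-middle A (marker (c (suc p)) s) R ⟩
  sum (marker (c (suc p)) s) + sum (A ++ R)
    ≡⟨ cong₂ _+_ (sum-marker (c (suc p)) s) (cong sum (sym without-marker)) ⟩
  (if c (suc p) then s else 0) + sum (selectBlocks c (suc s) xs V)
    ≡⟨ cong ((if c (suc p) then s else 0) +_) (sum-selectBlocks c (suc s) V xs xs∈V) ⟩
  (if c (suc p) then s else 0) + (suc s * E + E C 2 + O)
    ≡⟨ closed-form (c (suc p)) ⟩
  s * (ind (c (suc p)) + E) + (ind (c (suc p)) + E) C 2 + (if not (c (suc p)) then E else 0) + O
    ≡⟨ cong (λ k → s * (ind (c (suc p)) + E) + (ind (c (suc p)) + E) C 2 + k + O) (countᵇ-∧ˡ (not (c (suc p))) c xs) ⟨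
  s * (ind (c (suc p)) + E) + (ind (c (suc p)) + E) C 2 + countᵇ (λ y → not (c (suc p)) ∧ c y) xs + O
    ≡⟨ +-assoc (s * (ind (c (suc p)) + E) + (ind (c (suc p)) + E) C 2) _ O ⟩
  s * (ind (c (suc p)) + E) + (ind (c (suc p)) + E) C 2 + (countᵇ (λ y → not (c (suc p)) ∧ c y) xs + O) ∎
  where
  A : List ℕ
  A = selectBlocks c (suc s) xs p
  E O : ℕ
  E = countᵇ c xs
  O = invBy (λ x y → not (c x) ∧ c y) xs
  closed-form : ∀ b → (if b then s else 0) + (suc s * E + E C 2 + O) ≡
                       s * (ind b + E) + (ind b + E) C 2 + (if not b then E else 0) + O
  closed-form true  = trans (selected s E (E C 2) O) (cong (λ k → s * suc E + k + 0 + O) (sym (suc-C-2 E)))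
    where
    selected : ∀ s E c O → s + (suc s * E + c + O) ≡ s * suc E + (E + c) + 0 + O
    selected = solve-∀
  closed-form false = unselected s E (E C 2) O
    where
    unselected : ∀ s E c O → suc s * E + c + O ≡ s * E + c + E + O
    unselected = solve-∀

invW-selectBlocks : ∀ c s V w → All (InRange V) w →
  invW (selectBlocks c s w V) ≡ invBy (λ x y → c x ∧ (c y ∧ (y <ᵇ x))) w
invW-selectBlocks c s V []       []  = cong invW (selectBlocks-[] c s V)
invW-selectBlocks c s V (suc p ∷ xs) ((s≤s z≤n , p<V) ∷ xs∈V)
  with R , with-marker , without-marker ← selectBlocks-∷ c s p xs p<V = begin
  invW (selectBlocks c s (suc p ∷ xs) V)
    ≡⟨ cong invW with-marker ⟩
  invW (A ++ marker (c (suc p)) s ++ R)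
    ≡⟨ invW-insert-marker (c (suc p)) s A R (++⁻ˡ A A++R>s) (++⁻ʳ A A++R>s) ⟩
  (if c (suc p) then length A else 0) + invW (A ++ R)
    ≡⟨ cong₂ (λ k B → (if c (suc p) then k else 0) + invW B)
             (length-selectBlocks c (suc s) p xs (All.map proj₁ xs∈V)) (sym without-marker) ⟩
  (if c (suc p) then countᵇ (λ y → c y ∧ (y <ᵇ suc p)) xs else 0) + invW (selectBlocks c (suc s) xs V)
    ≡⟨ cong₂ _+_ (sym (countᵇ-∧ˡ (c (suc p)) (λ y → c y ∧ (y <ᵇ suc p)) xs)) (invW-selectBlocks c (suc s) V xs xs∈V) ⟩
  countᵇ (λ y → c (suc p) ∧ (c y ∧ (y <ᵇ suc p))) xs + invBy (λ x y → c x ∧ (c y ∧ (y <ᵇ x))) xs ∎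
  where
  A : List ℕ
  A = selectBlocks c (suc s) xs p
  A++R>s : All (s <_) (A ++ R)
  A++R>s = subst (All (s <_)) without-marker (selectBlocks-≥ c (suc s) xs V)

-- Lists cut into blocks of length l

module _ (l : ℕ) where

  length-concat-blocks : ∀ (F : ℕ → List ℕ) V → (∀ {p} → p < V → length (F p) ≡ l) →
                         length (concat (applyUpTo F V)) ≡ V * l
  length-concat-blocks F zero    length-F = refl
  length-concat-blocks F (suc V) length-F =
    trans (length-++ (F 0)) (cong₂ _+_ (length-F z<s) (length-concat-blocks (F ∘ suc) V (length-F ∘ s<s)))

  at-concat-blocks : ∀ (F : ℕ → List ℕ) V → (∀ {p} → p < V → length (F p) ≡ l) →
                     ∀ {p q} → p < V → q < l → at (concat (applyUpTo F V)) (p * l + suc q) ≡ at (F p) (suc q)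
  at-concat-blocks F (suc V) length-F {zero}  {q} _ q<l =
    at-++ˡ (F 0) _ (subst (q <_) (sym (length-F z<s)) q<l)
  at-concat-blocks F (suc V) length-F {suc p} {q} (s<s p<V) q<l = begin
    at (F 0 ++ rest) (l + p * l + suc q)           ≡⟨ cong (at (F 0 ++ rest)) shift ⟩
    at (F 0 ++ rest) (length (F 0) + suc (p * l + q)) ≡⟨ at-++ʳ (F 0) rest (p * l + q) ⟩
    at rest (suc (p * l + q))                      ≡⟨ cong (at rest) (+-suc (p * l) q) ⟨
    at rest (p * l + suc q)                        ≡⟨ at-concat-blocks (F ∘ suc) V (length-F ∘ s<s) p<V q<l ⟩
    at (F (suc p)) (suc q)                         ∎
    where
    rest : List ℕ
    rest = concat (applyUpTo (F ∘ suc) V)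
    shift : l + p * l + suc q ≡ length (F 0) + suc (p * l + q)
    shift = trans (+-assoc l (p * l) (suc q)) (cong₂ _+_ (sym (length-F z<s)) (+-suc (p * l) q))

sum-if-not : ∀ b (xs : List ℕ) → sum (if not b then xs else []) ≡ (if b then 0 else sum xs)
sum-if-not true  xs = refl
sum-if-not false xs = refl

module ConcatBlocks (l : ℕ) .{{_ : NonZero l}} (F : ℕ → List ℕ) (V : ℕ)
                    (length-F : ∀ {p} → p < V → length (F p) ≡ l) where

  blocks : List ℕ
  blocks = concat (applyUpTo F V)

  block : ℕ → List ℕ
  block p = map (λ q → at blocks (p * l + suc q)) (upTo l)

  blockCount : length blocks / l ≡ V
  blockCount = trans (cong (_/ l) (length-concat-blocks l F V length-F)) (m*n/n≡m V l)

  block≡F : ∀ {p} → p < V → block p ≡ F p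
  block≡F {p} p<V = begin
    map (λ q → at blocks (p * l + suc q)) (upTo l)      ≡⟨ map-upTo _ l ⟩
    applyUpTo (λ q → at blocks (p * l + suc q)) l       ≡⟨ applyUpTo-cong l (at-concat-blocks l F V length-F p<V) ⟩
    applyUpTo (λ q → at (F p) (suc q)) l                ≡⟨ map-upTo _ l ⟨
    map (λ q → at (F p) (suc q)) (upTo l)               ≡⟨ cong (λ n → map (λ q → at (F p) (suc q)) (upTo n)) (length-F p<V) ⟨
    map (λ q → at (F p) (suc q)) (upTo (length (F p)))  ≡⟨ map-at-upTo (F p) ⟩
    F p                                                  ∎

  select-blocks : ∀ (b : ℕ → Bool) → concatMap (λ p → if b p then block p else []) (upTo (length blocks / l)) ≡
                                     concat (applyUpTo (λ p → if b p then F p else []) V)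
  select-blocks b = begin
    concatMap G (upTo (length blocks / l)) ≡⟨ cong (λ n → concatMap G (upTo n)) blockCount ⟩
    concat (map G (upTo V))               ≡⟨ cong concat (map-upTo G V) ⟩
    concat (applyUpTo G V)                ≡⟨ cong concat (applyUpTo-cong V (λ {p} p<V → cong (λ X → if b p then X else []) (block≡F p<V))) ⟩
    concat (applyUpTo (λ p → if b p then F p else []) V) ∎
    where
    G : ℕ → List ℕ
    G p = if b p then block p else []

  -- blockSub compares parities with a private function; since even? (suc (suc p)) reduces to even? p,
  -- checking p = 0 and p = 1 identifies it with even? p (resp. not (even? p)).
  πo-blocks : πo l blocks ≡ concat (applyUpTo (λ p → if even? p then F p else []) V)
  πo-blocks = trans (select-cong block (two-step-induction refl refl (λ _ eq → eq)) (upTo (length blocks / l)))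
                    (select-blocks even?)

  πe-blocks : πe l blocks ≡ concat (applyUpTo (λ p → if not (even? p) then F p else []) V)
  πe-blocks = trans (select-cong block (two-step-induction refl refl (λ _ eq → eq)) (upTo (length blocks / l)))
                    (select-blocks (not ∘ even?))

  oddBlockSum-blocks : oddBlockSum l blocks ≡ sum (concat (applyUpTo (λ p → if not (even? p) then F p else []) V))
  oddBlockSum-blocks = begin
    sum (map G (upTo (length blocks / l)))   ≡⟨ cong (λ n → sum (map G (upTo n))) blockCount ⟩
    sum (map G (upTo V))                     ≡⟨ cong sum (map-upTo G V) ⟩
    sum (applyUpTo G V)                      ≡⟨ cong sum (applyUpTo-cong V (λ {p} p<V → trans (cong (λ X → if even? p then 0 else sum X) (block≡F p<V)) (sym (sum-if-not (even? p) (F p))))) ⟩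
    sum (applyUpTo (sum ∘ S) V)              ≡⟨ cong sum (map-applyUpTo S sum V) ⟨
    sum (map sum (applyUpTo S V))            ≡⟨ sum-concat (applyUpTo S V) ⟨
    sum (concat (applyUpTo S V))             ∎
    where
    G : ℕ → ℕ
    G p = if even? p then 0 else sum (block p)
    S : ℕ → List ℕ
    S p = if not (even? p) then F p else []

length-select-blocks : ∀ l (c : ℕ → Bool) (F : ℕ → List ℕ) V → (∀ {p} → p < V → length (F p) ≡ l) →
                       length (concat (applyUpTo (λ p → if c p then F p else []) V)) ≡ countᵇ c (upTo V) * l
length-select-blocks l c F zero    length-F = refl
length-select-blocks l c F (suc V) length-F = begin
  length ((if c 0 then F 0 else []) ++ concat (applyUpTo (λ p → if c (suc p) then F (suc p) else []) V))
    ≡⟨ length-++ (if c 0 then F 0 else []) ⟩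
  length (if c 0 then F 0 else []) + length (concat (applyUpTo (λ p → if c (suc p) then F (suc p) else []) V))
    ≡⟨ cong₂ _+_ (first (c 0)) (length-select-blocks l (c ∘ suc) (F ∘ suc) V (length-F ∘ s<s)) ⟩
  ind (c 0) * l + countᵇ (c ∘ suc) (upTo V) * l
    ≡⟨ *-distribʳ-+ l (ind (c 0)) _ ⟨
  (ind (c 0) + countᵇ (c ∘ suc) (upTo V)) * l
    ≡⟨ cong (λ k → (ind (c 0) + k) * l) (countᵇ-applyUpTo c suc V) ⟨
  countᵇ c (upTo (suc V)) * l ∎
  where
  first : ∀ b → length (if b then F 0 else []) ≡ ind b * l
  first true  = trans (length-F z<s) (sym (+-identityʳ l))
  first false = refl

-- Letters ordered evens first, and their ranks

-- The letter x ≥ 1 owns block pred x of the inverse word, so x is odd iff that block index is even.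
oddᵇ : ℕ → Bool
oddᵇ x = even? (pred x)

evenᵇ : ℕ → Bool
evenᵇ x = not (oddᵇ x)

-- y ⊏ᵇ x: y precedes x when the even letters are listed first, then the odd ones, each increasingly.
_⊏ᵇ_ : ℕ → ℕ → Bool
y ⊏ᵇ x = if oddᵇ x then evenᵇ y ∨ (y <ᵇ x) else evenᵇ y ∧ (y <ᵇ x)

invBy-⊏ : ∀ w → invBy (λ x y → not (evenᵇ x) ∧ evenᵇ y) w
              + invBy (λ x y → oddᵇ x ∧ (oddᵇ y ∧ (y <ᵇ x))) w
              + invBy (λ x y → evenᵇ x ∧ (evenᵇ y ∧ (y <ᵇ x))) w
              ≡ invBy (λ x y → y ⊏ᵇ x) w
invBy-⊏ w = trans (cong (_+ invBy _ w) (invBy-+ (λ x y → odd-first (oddᵇ x) (oddᵇ y) (y <ᵇ x)) w))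
                  (invBy-+ (λ x y → even-pairs (oddᵇ x) (oddᵇ y) (y <ᵇ x)) w)
  where
  odd-first : ∀ ox oy lt → ind (not (not ox) ∧ not oy) + ind (ox ∧ (oy ∧ lt)) ≡ ind (ox ∧ (not oy ∨ lt))
  odd-first true  true  lt    = refl
  odd-first true  false lt    = refl
  odd-first false oy    lt    = refl
  even-pairs : ∀ ox oy lt → ind (ox ∧ (not oy ∨ lt)) + ind (not ox ∧ (not oy ∧ lt))
                            ≡ ind (if ox then not oy ∨ lt else not oy ∧ lt)
  even-pairs true  oy lt = +-identityʳ _
  even-pairs false oy lt = refl

inverse : (l : ℕ) .{{_ : NonZero l}} → List ℕ → List ℕ
inverse l w = concatMap (λ k → positionsFrom 1 (suc k) w) (upTo (length w / l))

blockStatistic : (l : ℕ) .{{_ : NonZero l}} → List ℕ → ℤ.ℤ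
blockStatistic l π = ℤ.+ (length π * length π / 4) - ℤ.+ oddBlockSum l π - ℤ.+ invW (πo l π) - ℤ.+ invW (πe l π)

module InverseWord (l : ℕ) .{{_ : NonZero l}} (H : ℕ) (w : List ℕ)
                   (w∈range : All (InRange (H * 2)) w)
                   (w-counts : ∀ {p} → p < H * 2 → countᵇ (_≡ᵇ suc p) w ≡ l) where

  V : ℕ
  V = H * 2

  F : ℕ → List ℕ
  F p = positionsFrom 1 (suc p) w

  length-F : ∀ {p} → p < V → length (F p) ≡ l
  length-F {p} p<V = trans (length-positionsFrom 1 (suc p) w) (w-counts p<V)

  open ConcatBlocks l F V length-F

  count-in-range : ∀ c → countᵇ (λ y → c y ∧ (y <ᵇ suc V)) w ≡ countᵇ c w
  count-in-range c = countᵇ-cong (All.map in-range w∈range)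
    where
    in-range : ∀ {y} → InRange V y → c y ∧ (y <ᵇ suc V) ≡ c y
    in-range {y} (_ , y≤V) = trans (cong (c y ∧_) (<ᵇ-true (s≤s y≤V))) (∧-identityʳ (c y))

  length-w : length w ≡ V * l
  length-w = begin
    length w                                              ≡⟨ countᵇ-all (All.universal (λ _ → refl) w) ⟨
    countᵇ (λ _ → true) w                                 ≡⟨ count-in-range (λ _ → true) ⟨
    countᵇ (λ y → true ∧ (y <ᵇ suc V)) w                  ≡⟨ length-selectBlocks (λ _ → true) 1 V w (All.map proj₁ w∈range) ⟨
    length blocks                                         ≡⟨ length-concat-blocks l F V length-F ⟩
    V * l                                                 ∎

  inverse≡blocks : inverse l w ≡ blocks
  inverse≡blocks = trans (cong (λ n → concatMap F (upTo n)) (trans (cong (_/ l) length-w) (m*n/n≡m V l)))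
                         (cong concat (map-upTo F V))

  e : ℕ
  e = H * l

  evenCount : countᵇ evenᵇ w ≡ e
  evenCount = begin
    countᵇ evenᵇ w                                  ≡⟨ count-in-range evenᵇ ⟨
    countᵇ (λ y → evenᵇ y ∧ (y <ᵇ suc V)) w         ≡⟨ length-selectBlocks evenᵇ 1 V w (All.map proj₁ w∈range) ⟨
    length (selectBlocks evenᵇ 1 w V)               ≡⟨ length-select-blocks l (not ∘ even?) F V length-F ⟩
    countᵇ (not ∘ even?) (upTo V) * l               ≡⟨ cong (_* l) (countᵇ-odd-upTo H) ⟩
    H * l                                           ∎

  length-blocks : length blocks ≡ e * 2
  length-blocks = trans (length-concat-blocks l F V length-F) (reshape H l)
    where
    reshape : ∀ H l → H * 2 * l ≡ H * l * 2
    reshape = solve-∀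

  quarter : length blocks * length blocks / 4 ≡ e + e C 2 + e C 2
  quarter = begin
    length blocks * length blocks / 4   ≡⟨ cong (λ L → L * L / 4) length-blocks ⟩
    e * 2 * (e * 2) / 4                 ≡⟨ cong (_/ 4) (reshape e) ⟩
    e * e * 4 / 4                       ≡⟨ m*n/n≡m (e * e) 4 ⟩
    e * e                               ≡⟨ square-C-2 e ⟩
    e + e C 2 + e C 2                   ∎
    where
    reshape : ∀ e → e * 2 * (e * 2) ≡ e * e * 4
    reshape = solve-∀

  half : length (inverse l w) / 2 ≡ e
  half = trans (cong (λ π → length π / 2) inverse≡blocks) (trans (cong (_/ 2) length-blocks) (m*n/n≡m e 2))

  oddBlockSum-formula : oddBlockSum l blocks ≡ 1 * e + e C 2 + invBy (λ x y → not (evenᵇ x) ∧ evenᵇ y) w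
  oddBlockSum-formula = begin
    oddBlockSum l blocks                   ≡⟨ oddBlockSum-blocks ⟩
    sum (selectBlocks evenᵇ 1 w V)         ≡⟨ sum-selectBlocks evenᵇ 1 V w w∈range ⟩
    1 * countᵇ evenᵇ w + countᵇ evenᵇ w C 2 + invBy (λ x y → not (evenᵇ x) ∧ evenᵇ y) w
                                           ≡⟨ cong (λ E → 1 * E + E C 2 + invBy (λ x y → not (evenᵇ x) ∧ evenᵇ y) w) evenCount ⟩
    1 * e + e C 2 + invBy (λ x y → not (evenᵇ x) ∧ evenᵇ y) w ∎

  inverse-identity : blockStatistic l (inverse l w) ≡ ℤ.+ ((length (inverse l w) / 2) C 2) - ℤ.+ invBy (λ x y → y ⊏ᵇ x) w
  inverse-identity = begin
    blockStatistic l (inverse l w)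
      ≡⟨ cong (blockStatistic l) inverse≡blocks ⟩
    ℤ.+ (length blocks * length blocks / 4) - ℤ.+ oddBlockSum l blocks - ℤ.+ invW (πo l blocks) - ℤ.+ invW (πe l blocks)
      ≡⟨ cong₂ (λ a b → ℤ.+ a - ℤ.+ b - ℤ.+ invW (πo l blocks) - ℤ.+ invW (πe l blocks)) quarter oddBlockSum-formula ⟩
    ℤ.+ (e + e C 2 + e C 2) - ℤ.+ (1 * e + e C 2 + O) - ℤ.+ invW (πo l blocks) - ℤ.+ invW (πe l blocks)
      ≡⟨ cong₂ (λ i j → ℤ.+ (e + e C 2 + e C 2) - ℤ.+ (1 * e + e C 2 + O) - ℤ.+ i - ℤ.+ j)
               (trans (cong invW πo-blocks) (invW-selectBlocks oddᵇ 1 V w w∈range))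
               (trans (cong invW πe-blocks) (invW-selectBlocks evenᵇ 1 V w w∈range)) ⟩
    ℤ.+ (e + e C 2 + e C 2) - ℤ.+ (1 * e + e C 2 + O) - ℤ.+ Io - ℤ.+ Ie
      ≡⟨ ℤ-cancel e (e C 2) O Io Ie ⟩
    ℤ.+ (e C 2) - ℤ.+ (O + Io + Ie)
      ≡⟨ cong₂ (λ k i → ℤ.+ (k C 2) - ℤ.+ i) (sym half) (invBy-⊏ w) ⟩
    ℤ.+ ((length (inverse l w) / 2) C 2) - ℤ.+ invBy (λ x y → y ⊏ᵇ x) w ∎
    where
    O Io Ie : ℕ
    O  = invBy (λ x y → not (evenᵇ x) ∧ evenᵇ y) w
    Io = invBy (λ x y → oddᵇ x ∧ (oddᵇ y ∧ (y <ᵇ x))) w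
    Ie = invBy (λ x y → evenᵇ x ∧ (evenᵇ y ∧ (y <ᵇ x))) w

letterOfRank : ℕ → ℕ → ℕ
letterOfRank H k = if k <ᵇ H then 2 + 2 * k else 1 + 2 * (k ∸ H)

letterOfRank-even : ∀ {H k} → k < H → letterOfRank H k ≡ 2 + 2 * k
letterOfRank-even {H} {k} k<H = cong (λ b → if b then 2 + 2 * k else 1 + 2 * (k ∸ H)) (<ᵇ-true k<H)

letterOfRank-odd : ∀ H d → letterOfRank H (H + d) ≡ 1 + 2 * d
letterOfRank-odd H d = trans (cong (λ b → if b then 2 + 2 * (H + d) else 1 + 2 * (H + d ∸ H)) (<ᵇ-false (m≤m+n H d)))
                             (cong (λ k → 1 + 2 * k) (m+n∸m≡n H d))

oddᵇ-2+2* : ∀ k → oddᵇ (2 + 2 * k) ≡ false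
oddᵇ-2+2* k = cong (_≡ᵇ 0) (trans (cong (λ n → (1 + n) % 2) (*-comm 2 k)) ([m+kn]%n≡m%n 1 k 2))

oddᵇ-1+2* : ∀ d → oddᵇ (1 + 2 * d) ≡ true
oddᵇ-1+2* d = cong (_≡ᵇ 0) (trans (cong (_% 2) (*-comm 2 d)) (m*n%n≡0 d 2))

data RankView (H : ℕ) : ℕ → Set where
  even-rank : ∀ {k} → k < H → RankView H k
  odd-rank  : ∀ {d} → d < H → RankView H (H + d)

rankView : ∀ H {k} → k < H * 2 → RankView H k
rankView H {k} k<2H with k <? H
... | yes k<H = even-rank k<H
... | no  k≮H with d , refl ← m≤n⇒∃[o]m+o≡n (≮⇒≥ k≮H) =
  odd-rank (+-cancelˡ-< H d H (subst (H + d <_) (*2≡+ H) k<2H))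

2+2*-<ᵇ : ∀ a b → (2 + 2 * a <ᵇ 2 + 2 * b) ≡ (a <ᵇ b)
2+2*-<ᵇ a b = <ᵇ-cong (λ lt → *-cancelˡ-< 2 a b (+-cancelˡ-< 2 _ _ lt)) (λ lt → +-monoʳ-< 2 (*-monoʳ-< 2 lt))

1+2*-<ᵇ : ∀ a b → (1 + 2 * a <ᵇ 1 + 2 * b) ≡ (a <ᵇ b)
1+2*-<ᵇ a b = <ᵇ-cong (λ lt → *-cancelˡ-< 2 a b (+-cancelˡ-< 1 _ _ lt)) (λ lt → +-monoʳ-< 1 (*-monoʳ-< 2 lt))

⊏-letterOfRank : ∀ H {k k′} → k < H * 2 → k′ < H * 2 →
                 (letterOfRank H k′ ⊏ᵇ letterOfRank H k) ≡ (k′ <ᵇ k)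
⊏-letterOfRank H k<2H k′<2H with rankView H k<2H | rankView H k′<2H
... | even-rank {k} k<H | even-rank {k′} k′<H
  rewrite letterOfRank-even k<H | letterOfRank-even k′<H | oddᵇ-2+2* k | oddᵇ-2+2* k′ = 2+2*-<ᵇ k′ k
... | even-rank {k} k<H | odd-rank {d′} _
  rewrite letterOfRank-even k<H | letterOfRank-odd H d′ | oddᵇ-2+2* k | oddᵇ-1+2* d′ =
  sym (<ᵇ-false (≤-trans (<⇒≤ k<H) (m≤m+n H d′)))
... | odd-rank {d} _ | even-rank {k′} k′<H
  rewrite letterOfRank-odd H d | letterOfRank-even k′<H | oddᵇ-1+2* d | oddᵇ-2+2* k′ =
  sym (<ᵇ-true (<-≤-trans k′<H (m≤m+n H d)))
... | odd-rank {d} _ | odd-rank {d′} _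
  rewrite letterOfRank-odd H d | letterOfRank-odd H d′ | oddᵇ-1+2* d | oddᵇ-1+2* d′ =
  trans (1+2*-<ᵇ d′ d) (<ᵇ-cong (+-monoʳ-< H) (+-cancelˡ-< H d′ d))

invBy-⊏-letterOfRank : ∀ H {K} → All (_< H * 2) K → invBy (λ x y → y ⊏ᵇ x) (map (letterOfRank H) K) ≡ invW K
invBy-⊏-letterOfRank H {K} K<2H = begin
  invBy (λ x y → y ⊏ᵇ x) (map (letterOfRank H) K)                  ≡⟨ invBy-map (λ x y → y ⊏ᵇ x) (letterOfRank H) K ⟩
  invBy (λ k k′ → letterOfRank H k′ ⊏ᵇ letterOfRank H k) K         ≡⟨ invBy-cong (⊏-letterOfRank H) K<2H ⟩
  invBy (λ k k′ → k′ <ᵇ k) K                                       ≡⟨ invW≡invBy K ⟨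
  invW K                                                           ∎

letterOfRank-injective : ∀ H {k k′} → k < H * 2 → k′ < H * 2 → letterOfRank H k ≡ letterOfRank H k′ → k ≡ k′
letterOfRank-injective H k<2H k′<2H eq with rankView H k<2H | rankView H k′<2H
... | even-rank {k} k<H | even-rank {k′} k′<H =
  *-cancelˡ-≡ k k′ 2 (suc-injective (suc-injective (trans (sym (letterOfRank-even k<H)) (trans eq (letterOfRank-even k′<H)))))
... | even-rank {k} k<H | odd-rank {d′} _ =
  contradiction (trans (sym (oddᵇ-2+2* k)) (trans (cong oddᵇ (trans (sym (letterOfRank-even k<H)) (trans eq (letterOfRank-odd H d′)))) (oddᵇ-1+2* d′))) (λ ())
... | odd-rank {d} _ | even-rank {k′} k′<H =
  contradiction (trans (sym (oddᵇ-1+2* d)) (trans (cong oddᵇ (trans (sym (letterOfRank-odd H d)) (trans eq (letterOfRank-even k′<H)))) (oddᵇ-2+2* k′))) (λ ())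
... | odd-rank {d} _ | odd-rank {d′} _ =
  cong (H +_) (*-cancelˡ-≡ d d′ 2 (suc-injective (trans (sym (letterOfRank-odd H d)) (trans eq (letterOfRank-odd H d′)))))

letterOfRank-surjective : ∀ H {p} → p < H * 2 → ∃[ k ] k < H * 2 × letterOfRank H k ≡ suc p
letterOfRank-surjective H {p} p<2H with parityView p
... | even i = H + i , H+i<2H , trans (letterOfRank-odd H i) (cong suc (*-comm 2 i))
  where
  H+i<2H : H + i < H * 2
  H+i<2H = subst (H + i <_) (sym (*2≡+ H)) (+-monoʳ-< H (*-cancelʳ-< 2 i H p<2H))
... | odd i  = i , <-≤-trans i<H (m≤m*n H 2) , trans (letterOfRank-even i<H) (cong (2 +_) (*-comm 2 i))
  where
  i<H : i < H
  i<H = *-cancelʳ-< 2 i H (<-trans (n<1+n (i * 2)) p<2H)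

letterOfRank-once : ∀ H {p} → p < H * 2 → countᵇ (_≡ᵇ suc p) (map (letterOfRank H) (upTo (H * 2))) ≡ 1
letterOfRank-once H {p} p<2H with k₀ , k₀<2H , k₀↦p ← letterOfRank-surjective H p<2H = begin
  countᵇ (_≡ᵇ suc p) (map (letterOfRank H) (upTo (H * 2)))    ≡⟨ countᵇ-map (_≡ᵇ suc p) (letterOfRank H) (upTo (H * 2)) ⟩
  countᵇ (λ k → letterOfRank H k ≡ᵇ suc p) (upTo (H * 2))    ≡⟨ countᵇ-cong (applyUpTo⁺₁ id (H * 2) fibre) ⟩
  countᵇ (_≡ᵇ k₀) (upTo (H * 2))                              ≡⟨ countᵇ-≡ᵇ-upTo k₀<2H ⟩
  1                                                           ∎
  where
  fibre : ∀ {k} → k < H * 2 → (letterOfRank H k ≡ᵇ suc p) ≡ (k ≡ᵇ k₀)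
  fibre k<2H = ≡ᵇ-cong (λ eq → letterOfRank-injective H k<2H k₀<2H (trans eq (sym k₀↦p)))
                       (λ { refl → k₀↦p })

letterOfRank-range : ∀ H {k} → k < H * 2 → InRange (H * 2) (letterOfRank H k)
letterOfRank-range H k<2H with rankView H k<2H
... | even-rank {k} k<H rewrite letterOfRank-even k<H =
  s≤s z≤n , subst (_≤ H * 2) (suc-*2 k) (*-monoˡ-≤ 2 k<H)
... | odd-rank {d} d<H rewrite letterOfRank-odd H d =
  s≤s z≤n , ≤-trans (n≤1+n _) (subst (_≤ H * 2) (suc-*2 d) (*-monoˡ-≤ 2 d<H))

rankWord-identity : ∀ l .{{_ : NonZero l}} H {K} → All (_< H * 2) K → Replicates l K (upTo (H * 2)) →
  let w = map (letterOfRank H) K in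
  blockStatistic l (inverse l w) ≡ ℤ.+ ((length (inverse l w) / 2) C 2) - ℤ.+ invW K
rankWord-identity l H {K} K<2H K-replicates =
  trans (InverseWord.inverse-identity l H w w∈range w-counts)
        (cong (λ i → ℤ.+ ((length (inverse l w) / 2) C 2) - ℤ.+ i) (invBy-⊏-letterOfRank H K<2H))
  where
  w : List ℕ
  w = map (letterOfRank H) K
  w∈range : All (InRange (H * 2)) w
  w∈range = map⁺ (All.map (letterOfRank-range H) K<2H)
  w-counts : ∀ {p} → p < H * 2 → countᵇ (_≡ᵇ suc p) w ≡ l
  w-counts {p} p<2H = trans (map-replicates {l} {K} {upTo (H * 2)} (letterOfRank H) K-replicates (_≡ᵇ suc p))
                            (trans (cong (l *_) (letterOfRank-once H p<2H)) (*-identityʳ l))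

-- Dellac configurations

module ColumnReading {l m n : ℕ} (D : Config l m n) where

  rows : List (Fin (m * n))
  rows = allFin (m * n)

  cols : List (Fin (l * n))
  cols = allFin (l * n)

  column : Fin (l * n) → List ℕ
  column c = selectMap (λ r → D r c) toℕ rows

  rowWord : List ℕ
  rowWord = concatMap column cols

  word≡map-label : word {l} {m} {n} D ≡ map (λ r → label m n (r + 1)) rowWord
  word≡map-label = sym (trans (map-concatMap (λ r → label m n (r + 1)) column cols)
                              (concatMap-cong (λ c → map-selectMap (λ r → D r c) toℕ (λ r → label m n (r + 1)) rows) cols))

  rowWord-range : All (_< m * n) rowWord
  rowWord-range = concat⁺ (map⁺ (All.universal (λ c → concat⁺ (map⁺ (All.universal (λ r → cell-range c r) rows))) cols))
    where
    cell-range : ∀ c r → All (_< m * n) (if D r c then toℕ r ∷ [] else [])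
    cell-range c r with D r c
    ... | true  = toℕ<n r ∷ []
    ... | false = []

  rowWord-replicates : (∀ r → countᵇ (λ c → D r c) cols ≡ l) → Replicates l rowWord (upTo (m * n))
  rowWord-replicates row-sums q = begin
    countᵇ q (concat (map column cols))                        ≡⟨ countᵇ-concat q (map column cols) ⟩
    ∑ (map column cols) (countᵇ q)                             ≡⟨ ∑-map column (countᵇ q) cols ⟩
    ∑[ c ∈ cols ] countᵇ q (column c)                          ≡⟨ ∑-cong cols (λ c → trans (countᵇ-selectMap (λ r → D r c) toℕ q rows) (countᵇ≡∑ _ rows)) ⟩
    ∑[ c ∈ cols ] ∑[ r ∈ rows ] ind (D r c ∧ q (toℕ r))        ≡⟨ ∑-swap cols rows (λ c r → ind (D r c ∧ q (toℕ r))) ⟩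
    ∑[ r ∈ rows ] ∑[ c ∈ cols ] ind (D r c ∧ q (toℕ r))        ≡⟨ ∑-cong rows row-sum ⟩
    ∑[ r ∈ rows ] (l * ind (q (toℕ r)))                        ≡⟨ ∑-*ˡ rows l (λ r → ind (q (toℕ r))) ⟩
    l * ∑[ r ∈ rows ] ind (q (toℕ r))                          ≡⟨ cong (l *_) (countᵇ≡∑ (q ∘ toℕ) rows) ⟨
    l * countᵇ (q ∘ toℕ) rows                                  ≡⟨ cong (l *_) (countᵇ-allFin q (m * n)) ⟩
    l * countᵇ q (upTo (m * n))                                ∎
    where
    row-sum : ∀ r → ∑[ c ∈ cols ] ind (D r c ∧ q (toℕ r)) ≡ l * ind (q (toℕ r))
    row-sum r = begin
      ∑[ c ∈ cols ] ind (D r c ∧ q (toℕ r))          ≡⟨ ∑-cong cols (λ c → trans (ind-∧ (D r c) _) (*-comm (ind (D r c)) _)) ⟩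
      ∑[ c ∈ cols ] (ind (q (toℕ r)) * ind (D r c))  ≡⟨ ∑-*ˡ cols (ind (q (toℕ r))) (λ c → ind (D r c)) ⟩
      ind (q (toℕ r)) * ∑[ c ∈ cols ] ind (D r c)    ≡⟨ cong (ind (q (toℕ r)) *_) (trans (sym (countᵇ≡∑ _ cols)) (row-sums r)) ⟩
      ind (q (toℕ r)) * l                            ≡⟨ *-comm (ind (q (toℕ r))) l ⟩
      l * ind (q (toℕ r))                            ∎

  descents : Fin (l * n) → Fin (l * n) → ℕ
  descents c₁ c₂ = ∑[ r₁ ∈ rows ] ∑[ r₂ ∈ rows ] ind (D r₁ c₁ ∧ D r₂ c₂ ∧ (toℕ r₂ <ᵇ toℕ r₁))

  invW-column : ∀ c → invW (column c) ≡ 0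
  invW-column c = trans (invW-selectMap (λ r → D r c) toℕ rows) (invBy-none (AllPairs.map ascending (allFin-sorted (m * n))))
    where
    ascending : ∀ {r r′} → toℕ r < toℕ r′ → D r c ∧ (D r′ c ∧ (toℕ r′ <ᵇ toℕ r)) ≡ false
    ascending {r} {r′} r<r′ rewrite <ᵇ-false (<⇒≤ r<r′) | ∧-zeroʳ (D r′ c) = ∧-zeroʳ (D r c)

  cross-columns : ∀ c₁ c₂ → cross (column c₁) (column c₂) ≡ descents c₁ c₂
  cross-columns c₁ c₂ = begin
    ∑ (column c₁) (λ x → countᵇ (_<ᵇ x) (column c₂))
      ≡⟨ ∑-selectMap (λ r → D r c₁) toℕ (λ x → countᵇ (_<ᵇ x) (column c₂)) rows ⟩
    ∑[ r₁ ∈ rows ] (if D r₁ c₁ then countᵇ (_<ᵇ toℕ r₁) (column c₂) else 0)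
      ≡⟨ ∑-cong rows (λ r₁ → cong (λ k → if D r₁ c₁ then k else 0) (countᵇ-selectMap (λ r → D r c₂) toℕ (_<ᵇ toℕ r₁) rows)) ⟩
    ∑[ r₁ ∈ rows ] (if D r₁ c₁ then countᵇ (λ r₂ → D r₂ c₂ ∧ (toℕ r₂ <ᵇ toℕ r₁)) rows else 0)
      ≡⟨ ∑-cong rows (λ r₁ → trans (sym (countᵇ-∧ˡ (D r₁ c₁) _ rows)) (countᵇ≡∑ _ rows)) ⟩
    descents c₁ c₂ ∎

  invC-by-columns : invC {l} {m} {n} D ≡ ∑[ c₁ ∈ cols ] ∑[ c₂ ∈ cols ] (ind (toℕ c₁ <ᵇ toℕ c₂) * descents c₁ c₂)
  invC-by-columns = begin
    ∑[ r₁ ∈ rows ] ∑[ c₁ ∈ cols ] ∑[ r₂ ∈ rows ] countᵇ (λ c₂ → T r₁ c₁ r₂ c₂) cols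
      ≡⟨ ∑-cong rows (λ r₁ → ∑-cong cols (λ c₁ → ∑-cong rows (λ r₂ → countᵇ≡∑ _ cols))) ⟩
    ∑[ r₁ ∈ rows ] ∑[ c₁ ∈ cols ] ∑[ r₂ ∈ rows ] ∑[ c₂ ∈ cols ] ind (T r₁ c₁ r₂ c₂)
      ≡⟨ ∑-swap rows cols _ ⟩
    ∑[ c₁ ∈ cols ] ∑[ r₁ ∈ rows ] ∑[ r₂ ∈ rows ] ∑[ c₂ ∈ cols ] ind (T r₁ c₁ r₂ c₂)
      ≡⟨ ∑-cong cols (λ c₁ → ∑-cong rows (λ r₁ → ∑-swap rows cols _)) ⟩
    ∑[ c₁ ∈ cols ] ∑[ r₁ ∈ rows ] ∑[ c₂ ∈ cols ] ∑[ r₂ ∈ rows ] ind (T r₁ c₁ r₂ c₂)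
      ≡⟨ ∑-cong cols (λ c₁ → ∑-swap rows cols _) ⟩
    ∑[ c₁ ∈ cols ] ∑[ c₂ ∈ cols ] ∑[ r₁ ∈ rows ] ∑[ r₂ ∈ rows ] ind (T r₁ c₁ r₂ c₂)
      ≡⟨ ∑-cong cols (λ c₁ → ∑-cong cols (λ c₂ → factor c₁ c₂)) ⟩
    ∑[ c₁ ∈ cols ] ∑[ c₂ ∈ cols ] (ind (toℕ c₁ <ᵇ toℕ c₂) * descents c₁ c₂) ∎
    where
    T : Fin (m * n) → Fin (l * n) → Fin (m * n) → Fin (l * n) → Bool
    T r₁ c₁ r₂ c₂ = D r₁ c₁ ∧ D r₂ c₂ ∧ (toℕ r₂ <ᵇ toℕ r₁) ∧ (toℕ c₁ <ᵇ toℕ c₂)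
    split-last : ∀ a b x y → ind (a ∧ b ∧ x ∧ y) ≡ ind y * ind (a ∧ b ∧ x)
    split-last a b x true  rewrite ∧-identityʳ x = sym (+-identityʳ _)
    split-last a b x false rewrite ∧-zeroʳ x | ∧-zeroʳ b | ∧-zeroʳ a = refl
    factor : ∀ c₁ c₂ → ∑[ r₁ ∈ rows ] ∑[ r₂ ∈ rows ] ind (T r₁ c₁ r₂ c₂) ≡ ind (toℕ c₁ <ᵇ toℕ c₂) * descents c₁ c₂
    factor c₁ c₂ = begin
      ∑[ r₁ ∈ rows ] ∑[ r₂ ∈ rows ] ind (T r₁ c₁ r₂ c₂)
        ≡⟨ ∑-cong rows (λ r₁ → trans (∑-cong rows (λ r₂ → split-last (D r₁ c₁) (D r₂ c₂) (toℕ r₂ <ᵇ toℕ r₁) c₁<c₂))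
                                       (∑-*ˡ rows (ind c₁<c₂) (λ r₂ → ind (D r₁ c₁ ∧ D r₂ c₂ ∧ (toℕ r₂ <ᵇ toℕ r₁))))) ⟩
      ∑[ r₁ ∈ rows ] (ind c₁<c₂ * ∑[ r₂ ∈ rows ] ind (D r₁ c₁ ∧ D r₂ c₂ ∧ (toℕ r₂ <ᵇ toℕ r₁)))
        ≡⟨ ∑-*ˡ rows (ind c₁<c₂) (λ r₁ → ∑[ r₂ ∈ rows ] ind (D r₁ c₁ ∧ D r₂ c₂ ∧ (toℕ r₂ <ᵇ toℕ r₁))) ⟩
      ind (toℕ c₁ <ᵇ toℕ c₂) * descents c₁ c₂ ∎
      where
      c₁<c₂ : Bool
      c₁<c₂ = toℕ c₁ <ᵇ toℕ c₂

  invW-rowWord : invW rowWord ≡ invC {l} {m} {n} D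
  invW-rowWord = begin
    invW (concat (map column cols))
      ≡⟨ invW-concat (map column cols) ⟩
    ∑ (map column cols) invW + pairSum cross (map column cols)
      ≡⟨ cong₂ _+_ (trans (∑-map column invW cols) (trans (∑-cong cols invW-column) (∑-zero cols)))
                   (pairSum-map cross column cols) ⟩
    pairSum (λ c₁ c₂ → cross (column c₁) (column c₂)) cols
      ≡⟨ pairSum-sorted (λ c₁ c₂ → toℕ c₁ <ᵇ toℕ c₂) _ (λ c → <ᵇ-false (≤-refl {toℕ c}))
                        (AllPairs.map (λ c₁<c₂ → <ᵇ-true c₁<c₂ , <ᵇ-false (<⇒≤ c₁<c₂)) (allFin-sorted (l * n))) ⟩
    ∑[ c₁ ∈ cols ] ∑[ c₂ ∈ cols ] (ind (toℕ c₁ <ᵇ toℕ c₂) * cross (column c₁) (column c₂))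
      ≡⟨ ∑-cong cols (λ c₁ → ∑-cong cols (λ c₂ → cong (ind (toℕ c₁ <ᵇ toℕ c₂) *_) (cross-columns c₁ c₂))) ⟩
    ∑[ c₁ ∈ cols ] ∑[ c₂ ∈ cols ] (ind (toℕ c₁ <ᵇ toℕ c₂) * descents c₁ c₂)
      ≡⟨ invC-by-columns ⟨
    invC {l} {m} {n} D ∎

module DellacShape {l m n : ℕ} .{{_ : NonZero l}} (D : Config l m n) (isD : IsGenDellac l m n D)
                   (t₁ t₄ H : ℕ) (sizes : t₁ + m * n + t₄ ≡ H * 2)
                   (w₁-ranks : w₁ l m n ≡ rep l (map (letterOfRank H) (upTo t₁)))
                   (w₂-ranks : w₂ l m n ≡ rep l (map (letterOfRank H) (applyUpTo (t₁ + m * n +_) t₄)))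
                   (label-ranks : ∀ {r} → r < m * n → label m n (r + 1) ≡ letterOfRank H (t₁ + r)) where

  open ColumnReading {l} {m} {n} D
  open IsGenDellac isD using (rowCount)

  low high : List ℕ
  low  = rep l (upTo t₁)
  high = rep l (applyUpTo (t₁ + m * n +_) t₄)

  rankWord : List ℕ
  rankWord = low ++ map (t₁ +_) rowWord ++ high

  word-ranks : word {l} {m} {n} D ≡ map (letterOfRank H) (map (t₁ +_) rowWord)
  word-ranks = trans word≡map-label (trans (map-cong-local (All.map label-ranks rowWord-range))
                                           (map-∘ {g = letterOfRank H} {f = t₁ +_} rowWord))

  φ₁≡ranks : φ₁ l m n D ≡ map (letterOfRank H) rankWord
  φ₁≡ranks = begin
    w₁ l m n ++ word {l} {m} {n} D ++ w₂ l m n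
      ≡⟨ cong₂ _++_ w₁-ranks (cong₂ _++_ word-ranks w₂-ranks) ⟩
    rep l (map L (upTo t₁)) ++ map L (map (t₁ +_) rowWord) ++ rep l (map L (applyUpTo (t₁ + m * n +_) t₄))
      ≡⟨ cong₂ _++_ (sym (map-rep L l (upTo t₁))) (cong (map L (map (t₁ +_) rowWord) ++_) (sym (map-rep L l (applyUpTo (t₁ + m * n +_) t₄)))) ⟩
    map L low ++ map L (map (t₁ +_) rowWord) ++ map L high
      ≡⟨ trans (cong (map L low ++_) (sym (map-++ L _ high))) (sym (map-++ L low _)) ⟩
    map L rankWord ∎
    where
    L : ℕ → ℕ
    L = letterOfRank H

  t₁+mn≤2H : t₁ + m * n ≤ H * 2
  t₁+mn≤2H = subst (t₁ + m * n ≤_) sizes (m≤m+n (t₁ + m * n) t₄)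

  rankWord-range : All (_< H * 2) rankWord
  rankWord-range = ++⁺ (rep-All l (applyUpTo⁺₁ id t₁ (λ i<t₁ → <-≤-trans i<t₁ (≤-trans (m≤m+n t₁ (m * n)) t₁+mn≤2H))))
                  (++⁺ (map⁺ (All.map (λ r<mn → <-≤-trans (+-monoʳ-< t₁ r<mn) t₁+mn≤2H) rowWord-range))
                       (rep-All l (applyUpTo⁺₁ _ t₄ (λ {i} i<t₄ → subst (t₁ + m * n + i <_) sizes (+-monoʳ-< (t₁ + m * n) i<t₄)))))

  rankWord-replicates : Replicates l rankWord (upTo (H * 2))
  rankWord-replicates = subst (Replicates l rankWord) ranks
    (++-replicates {l} {low} {upTo t₁} (rep-replicates l (upTo t₁))
    (++-replicates {l} {map (t₁ +_) rowWord} {map (t₁ +_) (upTo (m * n))} {high} {applyUpTo (t₁ + m * n +_) t₄}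
                   (map-replicates {l} {rowWord} {upTo (m * n)} (t₁ +_) (rowWord-replicates rowCount))
                   (rep-replicates l (applyUpTo (t₁ + m * n +_) t₄))))
    where
    ranks : upTo t₁ ++ map (t₁ +_) (upTo (m * n)) ++ applyUpTo (t₁ + m * n +_) t₄ ≡ upTo (H * 2)
    ranks = begin
      upTo t₁ ++ map (t₁ +_) (upTo (m * n)) ++ applyUpTo (t₁ + m * n +_) t₄
        ≡⟨ cong (λ xs → upTo t₁ ++ xs ++ applyUpTo (t₁ + m * n +_) t₄) (map-upTo (t₁ +_) (m * n)) ⟩
      upTo t₁ ++ applyUpTo (t₁ +_) (m * n) ++ applyUpTo (t₁ + m * n +_) t₄
        ≡⟨ ++-assoc (upTo t₁) _ _ ⟨
      (upTo t₁ ++ applyUpTo (t₁ +_) (m * n)) ++ applyUpTo (t₁ + m * n +_) t₄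
        ≡⟨ cong (_++ applyUpTo (t₁ + m * n +_) t₄) (applyUpTo-++ id t₁ (m * n)) ⟨
      upTo (t₁ + m * n) ++ applyUpTo (t₁ + m * n +_) t₄
        ≡⟨ applyUpTo-++ id (t₁ + m * n) t₄ ⟨
      upTo (t₁ + m * n + t₄)
        ≡⟨ cong upTo sizes ⟩
      upTo (H * 2) ∎

  invW-rankWord : invW rankWord ≡ invC {l} {m} {n} D
  invW-rankWord = begin
    invW rankWord
      ≡⟨ invW-sandwich (m≤m+n t₁ (m * n))
           (rep-All l (applyUpTo⁺₁ id t₁ (λ i<t₁ → <⇒≤ i<t₁)))
           (map⁺ (All.map (λ r<mn → m≤m+n t₁ _ , +-monoʳ-≤ t₁ (<⇒≤ r<mn)) rowWord-range))
           (rep-All l (applyUpTo⁺₁ _ t₄ (λ _ → m≤m+n (t₁ + m * n) _)))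
           (invW-rep-sorted l (allPairs-applyUpTo⁺₁ id t₁ (λ i<j _ → <⇒≤ i<j)))
           (invW-rep-sorted l (allPairs-applyUpTo⁺₁ _ t₄ (λ i<j _ → +-monoʳ-≤ (t₁ + m * n) (<⇒≤ i<j)))) ⟩
    invW (map (t₁ +_) rowWord)
      ≡⟨ invW-map-+ t₁ rowWord ⟩
    invW rowWord
      ≡⟨ invW-rowWord ⟩
    invC {l} {m} {n} D ∎

  φ-identity : blockStatistic l (φ l m n D) ≡ ℤ.+ ((length (φ l m n D) / 2) C 2) - ℤ.+ invC {l} {m} {n} D
  φ-identity = begin
    blockStatistic l (inverse l (φ₁ l m n D))
      ≡⟨ cong (blockStatistic l ∘ inverse l) φ₁≡ranks ⟩
    blockStatistic l (inverse l (map (letterOfRank H) rankWord))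
      ≡⟨ rankWord-identity l H rankWord-range rankWord-replicates ⟩
    ℤ.+ ((length (inverse l (map (letterOfRank H) rankWord)) / 2) C 2) - ℤ.+ invW rankWord
      ≡⟨ cong₂ (λ w i → ℤ.+ ((length (inverse l w) / 2) C 2) - ℤ.+ i) (sym φ₁≡ranks) invW-rankWord ⟩
    ℤ.+ ((length (inverse l (φ₁ l m n D)) / 2) C 2) - ℤ.+ invC {l} {m} {n} D ∎

stepRange-length : ∀ a b t → b + 2 ≡ a + t * 2 → stepRange a b ≡ map (λ k → a + 2 * k) (upTo t)
stepRange-length a b t eq =
  cong (λ N → map (λ k → a + 2 * k) (upTo N)) (trans (cong (λ N → (N ∸ a) / 2) eq) (trans (cong (_/ 2) (m+n∸m≡n a (t * 2))) (m*n/n≡m t 2)))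

evens-ranks : ∀ {H t} → t ≤ H → map (λ k → 2 + 2 * k) (upTo t) ≡ map (letterOfRank H) (upTo t)
evens-ranks {H} {t} t≤H = map-cong-local (applyUpTo⁺₁ id t (λ k<t → sym (letterOfRank-even (<-≤-trans k<t t≤H))))

odds-ranks : ∀ H d t → map (λ k → (1 + 2 * d) + 2 * k) (upTo t) ≡ map (letterOfRank H) (applyUpTo (H + d +_) t)
odds-ranks H d t = begin
  map (λ k → 1 + 2 * d + 2 * k) (upTo t)             ≡⟨ map-upTo _ t ⟩
  applyUpTo (λ k → 1 + 2 * d + 2 * k) t             ≡⟨ applyUpTo-cong t (λ {k} _ → sym (rank k)) ⟩
  applyUpTo (λ k → letterOfRank H (H + d + k)) t    ≡⟨ map-applyUpTo (H + d +_) (letterOfRank H) t ⟨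
  map (letterOfRank H) (applyUpTo (H + d +_) t)     ∎
  where
  rank : ∀ k → letterOfRank H (H + d + k) ≡ 1 + 2 * d + 2 * k
  rank k = trans (cong (letterOfRank H) (+-assoc H d k)) (trans (letterOfRank-odd H (d + k)) (cong suc (*-distribˡ-+ 2 d k)))

label≡letterOfRank : ∀ (f : ℕ → ℕ) h t₁ r → f (r + 1) ≡ 2 + 2 * (t₁ + r) →
                     (if r + 1 <ᵇ h + 1 then f (r + 1) else 2 * (r + 1 ∸ h) ∸ 1) ≡ letterOfRank (t₁ + h) (t₁ + r)
label≡letterOfRank f h t₁ r f≡ with r <? h
... | yes r<h rewrite <ᵇ-true (+-monoˡ-< 1 r<h) | letterOfRank-even (+-monoʳ-< t₁ r<h) = f≡
... | no  r≮h with d , refl ← m≤n⇒∃[o]m+o≡n (≮⇒≥ r≮h) rewrite <ᵇ-false (+-monoˡ-≤ 1 (m≤m+n h d)) = begin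
  2 * (h + d + 1 ∸ h) ∸ 1                   ≡⟨ cong (λ k → 2 * k ∸ 1) (trans (cong (_∸ h) (+-assoc h d 1)) (m+n∸m≡n h (d + 1))) ⟩
  2 * (d + 1) ∸ 1                           ≡⟨ cong (_∸ 1) (reshape d) ⟩
  1 + 2 * d                                 ≡⟨ letterOfRank-odd (t₁ + h) d ⟨
  letterOfRank (t₁ + h) (t₁ + h + d)        ≡⟨ cong (letterOfRank (t₁ + h)) (+-assoc t₁ h d) ⟩
  letterOfRank (t₁ + h) (t₁ + (h + d))      ∎
  where
  reshape : ∀ d → 2 * (d + 1) ≡ suc (1 + 2 * d)
  reshape = solve-∀

module _ (l m n : ℕ) where

  label-if-even : even? (m * n) ≡ true → ∀ i → label m n i ≡
    (if i <ᵇ m * n / 2 + 1 then 2 * i + n * (m ∸ 2) + 2 else 2 * (i ∸ m * n / 2) ∸ 1)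
  label-if-even even-mn i rewrite even-mn = refl

  label-if-odd : even? (m * n) ≡ false → ∀ i → label m n i ≡
    (if i <ᵇ (m * n ∸ 1) / 2 + 1 then 2 * i + n * (m ∸ 2) + 1 else 2 * (i ∸ (m * n ∸ 1) / 2) ∸ 1)
  label-if-odd odd-mn i rewrite odd-mn = refl

  w₁-if-even : even? (m * n) ≡ true → w₁ l m n ≡ rep l (stepRange 2 (n * (m ∸ 2) + 2))
  w₁-if-even even-mn rewrite even-mn = refl

  w₁-if-odd : even? (m * n) ≡ false → w₁ l m n ≡ rep l (stepRange 2 ((m ∸ 2) * n + 1))
  w₁-if-odd odd-mn rewrite odd-mn = refl

  w₂-if-even : even? (m * n) ≡ true → w₂ l m n ≡ rep l (stepRange (m * n + 1) (2 * n * (m ∸ 1) + 1))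
  w₂-if-even even-mn rewrite even-mn = refl

  w₂-if-odd : even? (m * n) ≡ false → w₂ l m n ≡ rep l (stepRange (m * n + 2) (2 * (m ∸ 1) * n ∸ 1))
  w₂-if-odd odd-mn rewrite odd-mn = refl

-- mn = 2h: ranks 0 … j are w₁, j+1 … j+2h the rows, j+2h+1 … 2h+2j+1 are w₂
module EvenMN (l m′ n j : ℕ) (nm′≡2j : n * m′ ≡ j * 2) where

  m h t₁ H : ℕ
  m = 2 + m′
  h = n + j
  t₁ = suc j
  H = t₁ + h
  mn≡2h : m * n ≡ h * 2
  mn≡2h = trans (cong (λ k → n + (n + k)) (trans (*-comm m′ n) nm′≡2j)) (reshape n j)
    where
    reshape : ∀ n j → n + (n + j * 2) ≡ (n + j) * 2
    reshape = solve-∀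
  even-mn : even? (m * n) ≡ true
  even-mn = trans (cong (λ k → k % 2 ≡ᵇ 0) mn≡2h) (cong (_≡ᵇ 0) (m*n%n≡0 h 2))
  sizes : t₁ + m * n + t₁ ≡ H * 2
  sizes = trans (cong (λ k → t₁ + k + t₁) mn≡2h) (reshape t₁ h)
    where
    reshape : ∀ t h → t + h * 2 + t ≡ (t + h) * 2
    reshape = solve-∀
  label≡rank : ∀ {r} → r < m * n → label m n (r + 1) ≡ letterOfRank H (t₁ + r)
  label≡rank {r} _ = begin
    label m n (r + 1)
      ≡⟨ label-if-even l m n even-mn (r + 1) ⟩
    (if r + 1 <ᵇ m * n / 2 + 1 then 2 * (r + 1) + n * m′ + 2 else 2 * (r + 1 ∸ m * n / 2) ∸ 1)
      ≡⟨ cong (λ k → if r + 1 <ᵇ k + 1 then 2 * (r + 1) + n * m′ + 2 else 2 * (r + 1 ∸ k) ∸ 1)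
              (trans (cong (_/ 2) mn≡2h) (m*n/n≡m h 2)) ⟩
    (if r + 1 <ᵇ h + 1 then 2 * (r + 1) + n * m′ + 2 else 2 * (r + 1 ∸ h) ∸ 1)
      ≡⟨ label≡letterOfRank (λ i → 2 * i + n * m′ + 2) h t₁ r (trans (cong (λ k → 2 * (r + 1) + k + 2) nm′≡2j) (reshape r j)) ⟩
    letterOfRank H (t₁ + r) ∎
    where
    reshape : ∀ r j → 2 * (r + 1) + j * 2 + 2 ≡ 2 + 2 * (suc j + r)
    reshape = solve-∀
  w₁-ranks : w₁ l m n ≡ rep l (map (letterOfRank H) (upTo t₁))
  w₁-ranks = trans (w₁-if-even l m n even-mn) (cong (rep l) (trans (stepRange-length 2 (n * m′ + 2) t₁ length≡) (evens-ranks (m≤m+n t₁ h))))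
    where
    reshape : ∀ j → j * 2 + 2 + 2 ≡ 2 + suc j * 2
    reshape = solve-∀
    length≡ : n * m′ + 2 + 2 ≡ 2 + t₁ * 2
    length≡ = trans (cong (λ k → k + 2 + 2) nm′≡2j) (reshape j)
  w₂-ranks : w₂ l m n ≡ rep l (map (letterOfRank H) (applyUpTo (t₁ + m * n +_) t₁))
  w₂-ranks = trans (w₂-if-even l m n even-mn) (cong (rep l) (begin
    stepRange (m * n + 1) (2 * n * suc m′ + 1)
      ≡⟨ stepRange-length (m * n + 1) (2 * n * suc m′ + 1) t₁ length≡ ⟩
    map (λ k → m * n + 1 + 2 * k) (upTo t₁)
      ≡⟨ cong (λ a → map (λ k → a + 2 * k) (upTo t₁)) (trans (cong (_+ 1) mn≡2h) (reshape₁ h)) ⟩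
    map (λ k → 1 + 2 * h + 2 * k) (upTo t₁)
      ≡⟨ odds-ranks H h t₁ ⟩
    map (letterOfRank H) (applyUpTo (H + h +_) t₁)
      ≡⟨ cong (λ s → map (letterOfRank H) (applyUpTo (s +_) t₁)) (trans (cong (t₁ +_) mn≡2h) (reshape₂ t₁ h)) ⟨
    map (letterOfRank H) (applyUpTo (t₁ + m * n +_) t₁) ∎))
    where
    reshape₁ : ∀ h → h * 2 + 1 ≡ 1 + 2 * h
    reshape₁ = solve-∀
    reshape₂ : ∀ t h → t + h * 2 ≡ t + h + h
    reshape₂ = solve-∀
    reshape₃ : ∀ n m′ → 2 * n * suc m′ + 1 + 2 ≡ 2 * n + 2 * (n * m′) + 3
    reshape₃ = solve-∀
    reshape₄ : ∀ n j → 2 * n + 2 * (j * 2) + 3 ≡ (n + j) * 2 + 1 + suc j * 2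
    reshape₄ = solve-∀
    length≡ : 2 * n * suc m′ + 1 + 2 ≡ m * n + 1 + t₁ * 2
    length≡ = trans (reshape₃ n m′) (trans (cong (λ k → 2 * n + 2 * k + 3) nm′≡2j)
                (trans (reshape₄ n j) (cong (λ k → k + 1 + t₁ * 2) (sym mn≡2h))))

-- mn = 2h + 1: ranks 0 … j are w₁, j+1 … j+2h+1 the rows, j+2h+2 … 2h+2j+1 are w₂
module OddMN (l m′ n j : ℕ) (nm′≡1+2j : n * m′ ≡ 1 + j * 2) where

  m h t₁ H : ℕ
  m = 2 + m′
  h = n + j
  t₁ = suc j
  H = t₁ + h
  m′n≡1+2j : m′ * n ≡ 1 + j * 2
  m′n≡1+2j = trans (*-comm m′ n) nm′≡1+2j
  mn≡1+2h : m * n ≡ 1 + h * 2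
  mn≡1+2h = trans (cong (λ k → n + (n + k)) m′n≡1+2j) (reshape n j)
    where
    reshape : ∀ n j → n + (n + (1 + j * 2)) ≡ 1 + (n + j) * 2
    reshape = solve-∀
  odd-mn : even? (m * n) ≡ false
  odd-mn = trans (cong (λ k → k % 2 ≡ᵇ 0) mn≡1+2h) (cong (_≡ᵇ 0) ([m+kn]%n≡m%n 1 h 2))
  sizes : t₁ + m * n + j ≡ H * 2
  sizes = trans (cong (λ k → t₁ + k + j) mn≡1+2h) (reshape j h)
    where
    reshape : ∀ j h → suc j + (1 + h * 2) + j ≡ (suc j + h) * 2
    reshape = solve-∀
  label≡rank : ∀ {r} → r < m * n → label m n (r + 1) ≡ letterOfRank H (t₁ + r)
  label≡rank {r} _ = begin
    label m n (r + 1)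
      ≡⟨ label-if-odd l m n odd-mn (r + 1) ⟩
    (if r + 1 <ᵇ (m * n ∸ 1) / 2 + 1 then 2 * (r + 1) + n * m′ + 1 else 2 * (r + 1 ∸ (m * n ∸ 1) / 2) ∸ 1)
      ≡⟨ cong (λ k → if r + 1 <ᵇ k + 1 then 2 * (r + 1) + n * m′ + 1 else 2 * (r + 1 ∸ k) ∸ 1)
              (trans (cong (λ k → (k ∸ 1) / 2) mn≡1+2h) (m*n/n≡m h 2)) ⟩
    (if r + 1 <ᵇ h + 1 then 2 * (r + 1) + n * m′ + 1 else 2 * (r + 1 ∸ h) ∸ 1)
      ≡⟨ label≡letterOfRank (λ i → 2 * i + n * m′ + 1) h t₁ r (trans (cong (λ k → 2 * (r + 1) + k + 1) nm′≡1+2j) (reshape r j)) ⟩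
    letterOfRank H (t₁ + r) ∎
    where
    reshape : ∀ r j → 2 * (r + 1) + (1 + j * 2) + 1 ≡ 2 + 2 * (suc j + r)
    reshape = solve-∀
  w₁-ranks : w₁ l m n ≡ rep l (map (letterOfRank H) (upTo t₁))
  w₁-ranks = trans (w₁-if-odd l m n odd-mn) (cong (rep l) (trans (stepRange-length 2 (m′ * n + 1) t₁ length≡) (evens-ranks (m≤m+n t₁ h))))
    where
    reshape : ∀ j → 1 + j * 2 + 1 + 2 ≡ 2 + suc j * 2
    reshape = solve-∀
    length≡ : m′ * n + 1 + 2 ≡ 2 + t₁ * 2
    length≡ = trans (cong (λ k → k + 1 + 2) m′n≡1+2j) (reshape j)
  w₂-ranks : w₂ l m n ≡ rep l (map (letterOfRank H) (applyUpTo (t₁ + m * n +_) j))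
  w₂-ranks = trans (w₂-if-odd l m n odd-mn) (cong (rep l) (begin
    stepRange (m * n + 2) (2 * suc m′ * n ∸ 1)
      ≡⟨ stepRange-length (m * n + 2) (2 * suc m′ * n ∸ 1) j length≡ ⟩
    map (λ k → m * n + 2 + 2 * k) (upTo j)
      ≡⟨ cong (λ a → map (λ k → a + 2 * k) (upTo j)) (trans (cong (_+ 2) mn≡1+2h) (reshape₁ h)) ⟩
    map (λ k → 1 + 2 * suc h + 2 * k) (upTo j)
      ≡⟨ odds-ranks H (suc h) j ⟩
    map (letterOfRank H) (applyUpTo (H + suc h +_) j)
      ≡⟨ cong (λ s → map (letterOfRank H) (applyUpTo (s +_) j)) (trans (cong (t₁ +_) mn≡1+2h) (reshape₂ t₁ h)) ⟨
    map (letterOfRank H) (applyUpTo (t₁ + m * n +_) j) ∎))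
    where
    reshape₁ : ∀ h → 1 + h * 2 + 2 ≡ 1 + 2 * suc h
    reshape₁ = solve-∀
    reshape₂ : ∀ t h → t + (1 + h * 2) ≡ t + h + suc h
    reshape₂ = solve-∀
    reshape₃ : ∀ m′ n → 2 * suc m′ * n ≡ 2 * n + 2 * (m′ * n)
    reshape₃ = solve-∀
    reshape₄ : ∀ n j → 2 * n + 2 * (1 + j * 2) ≡ 2 + (2 * n + j * 2 * 2)
    reshape₄ = solve-∀
    reshape₅ : ∀ n j → suc (2 * n + j * 2 * 2) + 2 ≡ 1 + (n + j) * 2 + 2 + j * 2
    reshape₅ = solve-∀
    length≡ : 2 * suc m′ * n ∸ 1 + 2 ≡ m * n + 2 + j * 2
    length≡ = begin
      2 * suc m′ * n ∸ 1 + 2                ≡⟨ cong (λ k → k ∸ 1 + 2) (trans (reshape₃ m′ n) (trans (cong (λ k → 2 * n + 2 * k) m′n≡1+2j) (reshape₄ n j))) ⟩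
      suc (2 * n + j * 2 * 2) + 2           ≡⟨ reshape₅ n j ⟩
      1 + h * 2 + 2 + j * 2                 ≡⟨ cong (λ k → k + 2 + j * 2) mn≡1+2h ⟨
      m * n + 2 + j * 2                     ∎

open import Data.Integer using (+_)

proposition4p6 : (l m n : ℕ) .{{_ : NonZero l}} → 2 ≤ m → 1 ≤ n →
    (D : Config l m n) → IsGenDellac l m n D →
    let π = φ l m n D
        L = length π
    in + (L * L / 4) - + oddBlockSum l π - + invW (πo l π) - + invW (πe l π)
       ≡ + ((L / 2) C 2) - + invC {l} {m} {n} D
proposition4p6 l (suc (suc m′)) n (s≤s (s≤s z≤n)) _ D isD with parity-split (n * m′)
... | inj₁ (j , nm′≡2j) = DellacShape.φ-identity D isD t₁ t₁ H sizes w₁-ranks w₂-ranks label≡rank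
  where open EvenMN l m′ n j nm′≡2j
... | inj₂ (j , nm′≡1+2j) = DellacShape.φ-identity D isD t₁ j H sizes w₁-ranks w₂-ranks label≡rank
  where open OddMN l m′ n j nm′≡1+2j
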